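{- For all $\sigma_1,\sigma_2\in S(321)$, $\Theta(\sigma_1\oplus\sigma_2)=\Theta(\sigma_2)\otimes\Theta(\sigma_1)$.
   Context: $S(\tau)=\bigcup_n S_n(\tau)$, $S_n(\tau)$ being the permutations of $[n]$ avoiding the pattern $\tau$. For permutations, $\sigma^{+a}$ adds $a$ to every entry, $\sigma^{a\rtimes b}$ adds $b$ to every entry $\ge a$, $\sigma(x\ldots y)=\sigma(x)\cdots\sigma(y)$, and a dot is concatenation. Direct sum: $\alpha\oplus\beta=\alpha.\beta^{+|\alpha|}$. For $\beta\in S_n$, $T(\beta)=\{i:\beta^{ -1}(i)>i,\ \beta(i)>i\}$; for $\alpha\in S_m(132),\beta\in S_n(132)$ and $k=1+|T(\beta)|$, $\alpha\otimes\beta=\beta^{k\rtimes m}(1\ldots k-1).\alpha^{+(k-1)}.\beta^{k\rtimes m}(k\ldots n)$. Definition of $\Theta$: for $\sigma\in S_n(321)$ let $(P,Q)$ be the insertion and recording tableaux of the Robinson–Schensted (RSK) correspondence applied to $\sigma$ (at most two rows). $\Psi(\sigma)$ is the path of $2n$ steps $u=(1,1)$, $d=(1,-1)$ whose first $n$ steps are, for $i=1,\dots,n$, $u$ if $i$ is in the first row of $P$ and $d$ if in the second, and whose last $n$ steps are, for $j=n,\dots,1$, $u$ if $j$ is in the second row of $Q$ and $d$ if in the first; it is a Dyck path. In a Dyck path each up-step is matched with the first later down-step ending at the height where the up-step starts. Labelling up-steps left to right $n,\dots,1$ and down-steps left to right $1,\dots,n$, $\Phi^{ -1}(D)$ sends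 the label of each up-step to the label of its matched down-step; it is a bijection from Dyck paths of semilength $n$ onto $S_n(132)$. $\Theta=\Phi^{ -1}\circ\Psi:S_n(321)\to S_n(132)$. -}

module Defs where

open import Data.Nat using (ℕ; zero; suc; _+_; _∸_; _<_; _<ᵇ_; _≡ᵇ_; _<?_)
open import Data.Bool using (Bool; true; false; if_then_else_)
open import Data.List using (List; []; _∷_; _++_; map; length; upTo; take; drop; lookup; filter; reverse)
open import Data.Bool.ListAction using (any)
open import Relation.Nullary.Decidable using (_×-dec_)
open import Data.Maybe using (Maybe; just; nothing)
open import Data.Product using (_×_; _,_; proj₁; proj₂)
open import Data.Fin as Fin using (Fin)
open import Relation.Nullary using (¬_)
import Relation.Nullary
open import Relation.Binary.PropositionalEquality using (_≡_; refl)
open import Data.List.Relation.Binary.Permutation.Propositional using (_↭_)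

-- Permutations are lists in one-line notation with entries 1..n.

range : ℕ → List ℕ
range n = map suc (upTo n)

IsPerm : List ℕ → Set
IsPerm σ = σ ↭ range (length σ)

Avoids321 : List ℕ → Set
Avoids321 σ = (i j k : Fin (length σ)) → i Fin.< j → j Fin.< k →
  ¬ (lookup σ j < lookup σ i × lookup σ k < lookup σ j)

InS321 : List ℕ → Set
InS321 σ = IsPerm σ × Avoids321 σ

-- 1-based value at a position (0 if out of range)
at : List ℕ → ℕ → ℕ
at [] _ = 0
at (x ∷ xs) zero = 0
at (x ∷ xs) (suc zero) = x
at (x ∷ xs) (suc (suc i)) = at xs (suc i)

-- 1-based position of a value (0 if absent): β⁻¹
posOf : List ℕ → ℕ → ℕ
posOf [] v = 0
posOf (x ∷ xs) v = if x ≡ᵇ v then 1 else (if posOf xs v ≡ᵇ 0 then 0 else suc (posOf xs v))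

mem : ℕ → List ℕ → Bool
mem v xs = any (λ y → y ≡ᵇ v) xs

shift : ℕ → List ℕ → List ℕ
shift a = map (_+ a)

shiftFrom : ℕ → ℕ → List ℕ → List ℕ
shiftFrom a b = map (λ x → if x <ᵇ a then x else x + b)

_⊕_ : List ℕ → List ℕ → List ℕ
α ⊕ β = α ++ shift (length α) β

T : List ℕ → List ℕ
T β = filter (λ i → (i <? posOf β i) ×-dec (i <? at β i)) (range (length β))

_⊗_ : List ℕ → List ℕ → List ℕ
α ⊗ β = take (k ∸ 1) β' ++ shift (k ∸ 1) α ++ drop (k ∸ 1) β'
  where
  k = suc (length (T β))
  β' = shiftFrom k (length α) β

-- Robinson–Schensted (row insertion); tableaux are lists of rows.

Tableau : Set
Tableau = List (List ℕ)

insertRow : ℕ → List ℕ → Maybe ℕ × List ℕ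
insertRow x [] = nothing , x ∷ []
insertRow x (y ∷ ys) with x <ᵇ y
... | true = just y , x ∷ ys
... | false with insertRow x ys
...   | b , r = b , y ∷ r

-- insert x into a tableau: (new tableau, 0-based index of the row receiving the new box)
insertTab : ℕ → Tableau → Tableau × ℕ
insertTab x [] = (x ∷ []) ∷ [] , 0
insertTab x (r ∷ rs) with insertRow x r
... | nothing , r' = r' ∷ rs , 0
... | just y , r' with insertTab y rs
...   | rs' , k = r' ∷ rs' , suc k

addAt : ℕ → ℕ → Tableau → Tableau
addAt i _ [] = (i ∷ []) ∷ []
addAt i zero (r ∷ rs) = (r ++ i ∷ []) ∷ rs
addAt i (suc k) (r ∷ rs) = r ∷ addAt i k rs

rskFrom : ℕ → List ℕ → Tableau × Tableau → Tableau × Tableau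
rskFrom i [] PQ = PQ
rskFrom i (x ∷ xs) (P , Q) with insertTab x P
... | P' , k = rskFrom (suc i) xs (P' , addAt i k Q)

rsk : List ℕ → Tableau × Tableau
rsk σ = rskFrom 1 σ ([] , [])

row : ℕ → Tableau → List ℕ
row _ [] = []
row zero (r ∷ rs) = r
row (suc k) (r ∷ rs) = row k rs

data Step : Set where
  u d : Step

Ψ : List ℕ → List Step
Ψ σ = map (λ i → if mem i (row 0 P) then u else d) (range n)
   ++ map (λ j → if mem j (row 1 Q) then u else d) (reverse (range n))
  where
  n = length σ
  P = proj₁ (rsk σ)
  Q = proj₂ (rsk σ)

-- matching of up-steps and down-steps via a stack;
-- up-steps labelled n,…,1 and down-steps labelled 1,…,n from left to right.
-- Produces the pairs (label of up-step , label of matched down-step).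
matchPairs : List Step → ℕ → ℕ → List ℕ → List (ℕ × ℕ)
matchPairs [] _ _ _ = []
matchPairs (u ∷ s) up dn stack = matchPairs s (up ∸ 1) dn (up ∷ stack)
matchPairs (d ∷ s) up dn [] = matchPairs s up (suc dn) []
matchPairs (d ∷ s) up dn (a ∷ stack) = (a , dn) ∷ matchPairs s up (suc dn) stack

assoc : ℕ → List (ℕ × ℕ) → ℕ
assoc _ [] = 0
assoc i ((a , b) ∷ ps) = if a ≡ᵇ i then b else assoc i ps

semilength : List Step → ℕ
semilength s = length (filter (λ x → isU x) s)
  where
  isU : (x : Step) → Relation.Nullary.Dec (x ≡ u)
  isU u = Relation.Nullary.yes refl
  isU d = Relation.Nullary.no (λ ())

Φinv : List Step → List ℕ
Φinv D = map (λ i → assoc i ps) (range n)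
  where
  n = semilength D
  ps = matchPairs D n 1 []

Θ : List ℕ → List ℕ
Θ σ = Φinv (Ψ σ)

module Submission where

-- Write Ψ(σ) = Ψ₁(σ) · Ψ₂(σ) for the two halves of the Dyck path of σ:
-- Ψ₁ is read off the first row of the insertion tableau P, Ψ₂ off the
-- second row of the recording tableau Q.
--
-- (1) Dyck insertion (a statement about Φ⁻¹ alone).  If A climbs from height 0
--     to h, B descends from h to 0, |A| = |B| and D is a Dyck path, then
--     Φ⁻¹(A·D·B) = Φ⁻¹(D) ⊗ Φ⁻¹(A·B).  The stack matching of A·D·B is the
--     matching of A, then that of D (which never touches the stack left by A),
--     then that of B, each relabelled; moreover T(Φ⁻¹(A·B)) = {1, …, #d(A)}.
-- (2) RSK of a direct sum.  The tableaux of σ₁ ⊕ σ₂ are those of σ₁ with the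
--     shifted tableaux of σ₂ glued row by row to the right, hence
--     Ψ(σ₁ ⊕ σ₂) = Ψ₁(σ₁) · Ψ(σ₂) · Ψ₂(σ₁).
-- (3) For σ ∈ S(321), Ψ₁(σ) is a lattice path from 0 to some h and Ψ₂(σ) one
--     from h back to 0.  This follows from an invariant of the row insertion
--     of a 321-avoiding word (two rows, and a dominance between them).
-- The theorem rewrites the left side by (2) and applies (1) with the paths of (3).

open import Defs
open import Data.Nat
open import Data.Nat.Properties
open import Data.Nat.Tactic.RingSolver using (solve-∀)
open import Data.List hiding (lookup)
open import Data.List.Properties
open import Data.Product using (_×_; _,_; proj₁; proj₂; Σ; ∃)
open import Data.Sum using (_⊎_; inj₁; inj₂)
open import Data.Bool using (true; false; if_then_else_; _∨_)
open import Data.Bool.Properties using (∨-identityʳ; ∨-zeroʳ; ∨-assoc)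
open import Data.Maybe using (Maybe; just; nothing)
import Data.Maybe as Maybe
open import Data.Unit using (⊤; tt)
open import Data.Empty using (⊥; ⊥-elim)
open import Data.Fin using (Fin)
import Data.Fin as Fin
open import Function using (_∘_; id)
open import Relation.Binary.PropositionalEquality
open import Relation.Binary.Definitions using (tri<; tri≈; tri>)
open import Relation.Nullary using (¬_; Dec; yes; no)
open import Relation.Nullary.Decidable using (_×-dec_)
open import Data.List.Membership.Propositional using (_∈_; _∉_)
open import Data.List.Membership.Propositional.Properties using (∈-map⁺; ∈-map⁻; ∈-++⁺ˡ; ∈-++⁺ʳ; ∈-++⁻)
open import Data.List.Relation.Unary.Any using (here; there; index)
open import Data.List.Relation.Unary.Any.Properties using (lookup-index)
open import Data.List.Relation.Unary.AllPairs using (AllPairs; []; _∷_)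
open import Data.List.Relation.Unary.All as All using (All; []; _∷_)
open import Data.List.Relation.Binary.Permutation.Propositional using (_↭_)
open import Data.List.Relation.Binary.Permutation.Propositional.Properties using (∈-resp-↭)
import Data.List.Relation.Binary.Permutation.Propositional as Perm

Every : {A : Set} → (A → Set) → List A → Set
Every Q xs = ∀ {x} → x ∈ xs → Q x

Every-∷ : {A : Set} {Q : A → Set} {x : A} {xs : List A} → Q x → Every Q xs → Every Q (x ∷ xs)
Every-∷ q e (here refl) = q
Every-∷ q e (there m) = e m

Every-tail : {A : Set} {Q : A → Set} {x : A} {xs : List A} → Every Q (x ∷ xs) → Every Q xs
Every-tail e m = e (there m)

Every-++ : {A : Set} {Q : A → Set} (xs : List A) {ys : List A} → Every Q xs → Every Q ys → Every Q (xs ++ ys)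
Every-++ xs e1 e2 m with ∈-++⁻ xs m
... | inj₁ m1 = e1 m1
... | inj₂ m2 = e2 m2

map-cong-Every : {A B : Set} {F G : A → B} (xs : List A) → Every (λ p → F p ≡ G p) xs → map F xs ≡ map G xs
map-cong-Every xs e = map-cong-local (All.tabulate e)

≡ᵇ-refl : ∀ x → (x ≡ᵇ x) ≡ true
≡ᵇ-refl zero = refl
≡ᵇ-refl (suc x) = ≡ᵇ-refl x

≢⇒≡ᵇ-false : ∀ x y → x ≢ y → (x ≡ᵇ y) ≡ false
≢⇒≡ᵇ-false zero zero ne = ⊥-elim (ne refl)
≢⇒≡ᵇ-false zero (suc y) ne = refl
≢⇒≡ᵇ-false (suc x) zero ne = refl
≢⇒≡ᵇ-false (suc x) (suc y) ne = ≢⇒≡ᵇ-false x y (λ e → ne (cong suc e))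

≡ᵇ-true⇒≡ : ∀ x y → (x ≡ᵇ y) ≡ true → x ≡ y
≡ᵇ-true⇒≡ zero zero e = refl
≡ᵇ-true⇒≡ zero (suc y) ()
≡ᵇ-true⇒≡ (suc x) zero ()
≡ᵇ-true⇒≡ (suc x) (suc y) e = cong suc (≡ᵇ-true⇒≡ x y e)

<⇒<ᵇ-true : ∀ x y → x < y → (x <ᵇ y) ≡ true
<⇒<ᵇ-true zero (suc y) _ = refl
<⇒<ᵇ-true (suc x) (suc y) (s≤s l) = <⇒<ᵇ-true x y l

≥⇒<ᵇ-false : ∀ x y → y ≤ x → (x <ᵇ y) ≡ false
≥⇒<ᵇ-false x zero _ = refl
≥⇒<ᵇ-false (suc x) (suc y) (s≤s l) = ≥⇒<ᵇ-false x y l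

<ᵇ-true⇒< : ∀ x y → (x <ᵇ y) ≡ true → x < y
<ᵇ-true⇒< x y e = <ᵇ⇒< x y (subst Data.Bool.T (sym e) tt)

<ᵇ-false⇒≥ : ∀ x y → (x <ᵇ y) ≡ false → y ≤ x
<ᵇ-false⇒≥ x y e = ≮⇒≥ (λ lt → subst (λ b → b ≡ false → ⊥) (sym (<⇒<ᵇ-true x y lt)) (λ ()) e)

applyUpTo-cong : {A : Set} (f g : ℕ → A) (n : ℕ) → (∀ i → i < n → f i ≡ g i) → applyUpTo f n ≡ applyUpTo g n
applyUpTo-cong f g zero h = refl
applyUpTo-cong f g (suc n) h = cong₂ _∷_ (h 0 (s≤s z≤n)) (applyUpTo-cong (f ∘ suc) (g ∘ suc) n (λ i lt → h (suc i) (s≤s lt)))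

applyUpTo-++ : {A : Set} (f : ℕ → A) (a b : ℕ) → applyUpTo f (a + b) ≡ applyUpTo f a ++ applyUpTo (λ i → f (a + i)) b
applyUpTo-++ f zero b = refl
applyUpTo-++ f (suc a) b = cong (f 0 ∷_) (applyUpTo-++ (f ∘ suc) a b)

take-applyUpTo : {A : Set} (f : ℕ → A) (a b : ℕ) → take a (applyUpTo f (a + b)) ≡ applyUpTo f a
take-applyUpTo f zero b = refl
take-applyUpTo f (suc a) b = cong (f 0 ∷_) (take-applyUpTo (f ∘ suc) a b)

drop-applyUpTo : {A : Set} (f : ℕ → A) (a b : ℕ) → drop a (applyUpTo f (a + b)) ≡ applyUpTo (λ i → f (a + i)) b
drop-applyUpTo f zero b = refl
drop-applyUpTo f (suc a) b = drop-applyUpTo (f ∘ suc) a b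

∈-applyUpTo⁻ : ∀ (f : ℕ → ℕ) n {x} → x ∈ applyUpTo f n → ∃ λ i → i < n × x ≡ f i
∈-applyUpTo⁻ f (suc n) (here e) = 0 , s≤s z≤n , e
∈-applyUpTo⁻ f (suc n) (there m) with ∈-applyUpTo⁻ (f ∘ suc) n m
... | i , lt , e = suc i , s≤s lt , e

All-applyUpTo : ∀ {Q : ℕ → Set} (f : ℕ → ℕ) n → (∀ i → i < n → Q (f i)) → All Q (applyUpTo f n)
All-applyUpTo f zero h = []
All-applyUpTo f (suc n) h = h 0 (s≤s z≤n) ∷ All-applyUpTo (f ∘ suc) n (λ i lt → h (suc i) (s≤s lt))

map-range : {A : Set} (G : ℕ → A) (n : ℕ) → map G (range n) ≡ applyUpTo (λ i → G (suc i)) n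
map-range G n = trans (cong (map G) (map-applyUpTo id suc n)) (map-applyUpTo suc G n)

length≡0⇒[] : {A : Set} (xs : List A) → length xs ≡ 0 → xs ≡ []
length≡0⇒[] [] _ = refl

∉-length≡0 : {A : Set} {x : A} (xs : List A) → length xs ≡ 0 → x ∉ xs
∉-length≡0 [] _ ()

nu nd : List Step → ℕ
nu [] = 0
nu (u ∷ s) = suc (nu s)
nu (d ∷ s) = nu s
nd [] = 0
nd (u ∷ s) = nd s
nd (d ∷ s) = suc (nd s)

nu-++ : ∀ s r → nu (s ++ r) ≡ nu s + nu r
nu-++ [] r = refl
nu-++ (u ∷ s) r = cong suc (nu-++ s r)
nu-++ (d ∷ s) r = nu-++ s r

nd-++ : ∀ s r → nd (s ++ r) ≡ nd s + nd r
nd-++ [] r = refl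
nd-++ (u ∷ s) r = nd-++ s r
nd-++ (d ∷ s) r = cong suc (nd-++ s r)

length≡nu+nd : ∀ s → length s ≡ nu s + nd s
length≡nu+nd [] = refl
length≡nu+nd (u ∷ s) = cong suc (length≡nu+nd s)
length≡nu+nd (d ∷ s) = trans (cong suc (length≡nu+nd s)) (sym (+-suc (nu s) (nd s)))

semilength≡nu : ∀ s → semilength s ≡ nu s
semilength≡nu [] = refl
semilength≡nu (u ∷ s) = cong suc (semilength≡nu s)
semilength≡nu (d ∷ s) = semilength≡nu s

data Path : ℕ → List Step → ℕ → Set where
  pnil : ∀ {h} → Path h [] h
  pup : ∀ {h s h'} → Path (suc h) s h' → Path h (u ∷ s) h'
  pdn : ∀ {h s h'} → Path h s h' → Path (suc h) (d ∷ s) h'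

path-++ : ∀ {h s h' r h''} → Path h s h' → Path h' r h'' → Path h (s ++ r) h''
path-++ pnil q = q
path-++ (pup p) q = pup (path-++ p q)
path-++ (pdn p) q = pdn (path-++ p q)

path-balance : ∀ {h s h'} → Path h s h' → h + nu s ≡ h' + nd s
path-balance pnil = refl
path-balance {h} (pup {s = s} p) = trans (+-suc h (nu s)) (path-balance p)
path-balance {s = d ∷ s} {h'} (pdn p) = trans (cong suc (path-balance p)) (sym (+-suc h' (nd s)))

path-from-prefixes : ∀ h w → (∀ k → nd (take k w) ≤ h + nu (take k w)) → Path h w (h + nu w ∸ nd w)
path-from-prefixes h [] c = subst (Path h []) (sym (+-identityʳ h)) pnil
path-from-prefixes h (u ∷ w) c = subst (Path h (u ∷ w)) (cong (_∸ nd w) (sym (+-suc h (nu w))))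
  (pup (path-from-prefixes (suc h) w (λ k → subst (nd (take k w) ≤_) (+-suc h (nu (take k w))) (c (suc k)))))
path-from-prefixes zero (d ∷ w) c with c 1
... | ()
path-from-prefixes (suc h) (d ∷ w) c = pdn (path-from-prefixes h w (λ k → s≤s⁻¹ (c (suc k))))

flipStep : Step → Step
flipStep u = d
flipStep d = u

path-reverse : ∀ {a w b} → Path a w b → Path b (reverse (map flipStep w)) a
path-reverse pnil = pnil
path-reverse {a} (pup {s = w} p) = subst (λ z → Path _ z a) (sym (unfold-reverse d (map flipStep w))) (path-++ (path-reverse p) (pdn pnil))
path-reverse {suc a} (pdn {s = w} p) = subst (λ z → Path _ z (suc a)) (sym (unfold-reverse u (map flipStep w))) (path-++ (path-reverse p) (pup pnil))

-- The stack matching.  matchPairs s up dn st (Defs) reads s with the next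
-- up-label up (labels decrease), the next down-label dn (labels increase)
-- and the stack st of unmatched up-labels; stackAfter is the final stack.

stackAfter : List Step → ℕ → List ℕ → List ℕ
stackAfter [] up st = st
stackAfter (u ∷ s) up st = stackAfter s (up ∸ 1) (up ∷ st)
stackAfter (d ∷ s) up [] = stackAfter s up []
stackAfter (d ∷ s) up (a ∷ st) = stackAfter s up st

matchPairs-++ : ∀ s r up dn st → matchPairs (s ++ r) up dn st ≡
  matchPairs s up dn st ++ matchPairs r (up ∸ nu s) (dn + nd s) (stackAfter s up st)
matchPairs-++ [] r up dn st = cong (λ z → matchPairs r up z st) (sym (+-identityʳ dn))
matchPairs-++ (u ∷ s) r up dn st = trans (matchPairs-++ s r (up ∸ 1) dn (up ∷ st))
  (cong (λ z → matchPairs s (up ∸ 1) dn (up ∷ st) ++ matchPairs r z (dn + nd s) (stackAfter s (up ∸ 1) (up ∷ st))) (∸-+-assoc up 1 (nu s)))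
matchPairs-++ (d ∷ s) r up dn [] = trans (matchPairs-++ s r up (suc dn) [])
  (cong (λ z → matchPairs s up (suc dn) [] ++ matchPairs r (up ∸ nu s) z (stackAfter s up [])) (sym (+-suc dn (nd s))))
matchPairs-++ (d ∷ s) r up dn (a ∷ st) = cong ((a , dn) ∷_) (trans (matchPairs-++ s r up (suc dn) st)
  (cong (λ z → matchPairs s up (suc dn) st ++ matchPairs r (up ∸ nu s) z (stackAfter s up st)) (sym (+-suc dn (nd s)))))

-- A path from h only ever pops the top h entries of the stack: the rest of
-- the stack is an untouched frame (the Dyck part D of A·D·B leaves A's stack alone).
matchPairs-frame : ∀ {h s h'} → Path h s h' → ∀ up dn top rest → length top ≡ h →
  matchPairs s up dn (top ++ rest) ≡ matchPairs s up dn top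
matchPairs-frame pnil up dn top rest eq = refl
matchPairs-frame (pup p) up dn top rest eq = matchPairs-frame p (up ∸ 1) dn (up ∷ top) rest (cong suc eq)
matchPairs-frame (pdn p) up dn (a ∷ top) rest eq = cong ((a , dn) ∷_) (matchPairs-frame p up (suc dn) top rest (suc-injective eq))
matchPairs-frame (pdn p) up dn [] rest ()

stackAfter-frame : ∀ {h s h'} → Path h s h' → ∀ up top rest → length top ≡ h →
  stackAfter s up (top ++ rest) ≡ stackAfter s up top ++ rest
stackAfter-frame pnil up top rest eq = refl
stackAfter-frame (pup p) up top rest eq = stackAfter-frame p (up ∸ 1) (up ∷ top) rest (cong suc eq)
stackAfter-frame (pdn p) up (a ∷ top) rest eq = stackAfter-frame p up top rest (suc-injective eq)
stackAfter-frame (pdn p) up [] rest ()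

stackAfter-length : ∀ {h s h'} → Path h s h' → ∀ up top → length top ≡ h → length (stackAfter s up top) ≡ h'
stackAfter-length pnil up top eq = eq
stackAfter-length (pup p) up top eq = stackAfter-length p (up ∸ 1) (up ∷ top) (cong suc eq)
stackAfter-length (pdn p) up (a ∷ top) eq = stackAfter-length p up top (suc-injective eq)
stackAfter-length (pdn p) up [] ()

relabelPair : (ℕ → ℕ) → ℕ → ℕ × ℕ → ℕ × ℕ
relabelPair f e p = f (proj₁ p) , proj₂ p + e

relabel-tail : ∀ (f : ℕ → ℕ) s up up' → (∀ j → j < suc (nu s) → f (up ∸ j) ≡ up' ∸ j) →
  ∀ j → j < nu s → f (up ∸ 1 ∸ j) ≡ up' ∸ 1 ∸ j
relabel-tail f s up up' h j lt = trans (cong f (∸-+-assoc up 1 j)) (trans (h (suc j) (s≤s lt)) (sym (∸-+-assoc up' 1 j)))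

matchPairs-relabel : ∀ (f : ℕ → ℕ) e s up up' dn st → (∀ j → j < nu s → f (up ∸ j) ≡ up' ∸ j) →
  matchPairs s up' (dn + e) (map f st) ≡ map (relabelPair f e) (matchPairs s up dn st)
matchPairs-relabel f e [] up up' dn st h = refl
matchPairs-relabel f e (u ∷ s) up up' dn st h =
  trans (cong (λ z → matchPairs s (up' ∸ 1) (dn + e) (z ∷ map f st)) (sym (h 0 (s≤s z≤n))))
        (matchPairs-relabel f e s (up ∸ 1) (up' ∸ 1) dn (up ∷ st) (relabel-tail f s up up' h))
matchPairs-relabel f e (d ∷ s) up up' dn [] h = matchPairs-relabel f e s up up' (suc dn) [] h
matchPairs-relabel f e (d ∷ s) up up' dn (a ∷ st) h = cong ((f a , dn + e) ∷_) (matchPairs-relabel f e s up up' (suc dn) st h)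

stackAfter-relabel : ∀ (f : ℕ → ℕ) s up up' st → (∀ j → j < nu s → f (up ∸ j) ≡ up' ∸ j) →
  stackAfter s up' (map f st) ≡ map f (stackAfter s up st)
stackAfter-relabel f [] up up' st h = refl
stackAfter-relabel f (u ∷ s) up up' st h =
  trans (cong (λ z → stackAfter s (up' ∸ 1) (z ∷ map f st)) (sym (h 0 (s≤s z≤n))))
        (stackAfter-relabel f s (up ∸ 1) (up' ∸ 1) (up ∷ st) (relabel-tail f s up up' h))
stackAfter-relabel f (d ∷ s) up up' [] h = stackAfter-relabel f s up up' [] h
stackAfter-relabel f (d ∷ s) up up' (a ∷ st) h = stackAfter-relabel f s up up' st h

Pushed : List Step → ℕ → ℕ → Set
Pushed s up x = ∃ λ j → j < nu s × x ≡ up ∸ j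

pushed-tail : ∀ {Q : ℕ → Set} s up → (∀ j → j < suc (nu s) → Q (up ∸ j)) → ∀ j → j < nu s → Q (up ∸ 1 ∸ j)
pushed-tail {Q} s up h j lt = subst Q (sym (∸-+-assoc up 1 j)) (h (suc j) (s≤s lt))

keys-invariant : ∀ (Q : ℕ → Set) s up dn st → Every Q st → (∀ j → j < nu s → Q (up ∸ j)) →
  Every (Q ∘ proj₁) (matchPairs s up dn st) × Every Q (stackAfter s up st)
keys-invariant Q [] up dn st est h = (λ ()) , est
keys-invariant Q (u ∷ s) up dn st est h = keys-invariant Q s (up ∸ 1) dn (up ∷ st) (Every-∷ (h 0 (s≤s z≤n)) est) (pushed-tail {Q} s up h)
keys-invariant Q (d ∷ s) up dn [] est h = keys-invariant Q s up (suc dn) [] est h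
keys-invariant Q (d ∷ s) up dn (a ∷ st) est h with keys-invariant Q s up (suc dn) st (est ∘ there) h
... | k , r = Every-∷ (est (here refl)) k , r

values-range : ∀ s up dn st → Every (λ p → dn ≤ proj₂ p × proj₂ p < dn + nd s) (matchPairs s up dn st)
values-range [] up dn st ()
values-range (u ∷ s) up dn st m = values-range s (up ∸ 1) dn (up ∷ st) m
values-range (d ∷ s) up dn [] {x} m with values-range s up (suc dn) [] m
... | l , r = <⇒≤ l , subst (proj₂ x <_) (sym (+-suc dn (nd s))) r
values-range (d ∷ s) up dn (a ∷ st) (here refl) = ≤-refl , subst (dn <_) (sym (+-suc dn (nd s))) (s≤s (m≤m+n dn (nd s)))
values-range (d ∷ s) up dn (a ∷ st) {x} (there m) with values-range s up (suc dn) st m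
... | l , r = <⇒≤ l , subst (proj₂ x <_) (sym (+-suc dn (nd s))) r

pushed-matched-or-stacked : ∀ s up dn st x → (x ∈ st ⊎ Pushed s up x) →
  x ∈ map proj₁ (matchPairs s up dn st) ⊎ x ∈ stackAfter s up st
pushed-matched-or-stacked [] up dn st x (inj₁ m) = inj₂ m
pushed-matched-or-stacked [] up dn st x (inj₂ (j , () , _))
pushed-matched-or-stacked (u ∷ s) up dn st x (inj₁ m) = pushed-matched-or-stacked s (up ∸ 1) dn (up ∷ st) x (inj₁ (there m))
pushed-matched-or-stacked (u ∷ s) up dn st x (inj₂ (zero , lt , e)) = pushed-matched-or-stacked s (up ∸ 1) dn (up ∷ st) x (inj₁ (here e))
pushed-matched-or-stacked (u ∷ s) up dn st x (inj₂ (suc j , s≤s lt , e)) =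
  pushed-matched-or-stacked s (up ∸ 1) dn (up ∷ st) x (inj₂ (j , lt , trans e (sym (∸-+-assoc up 1 j))))
pushed-matched-or-stacked (d ∷ s) up dn [] x (inj₁ ())
pushed-matched-or-stacked (d ∷ s) up dn [] x (inj₂ p) = pushed-matched-or-stacked s up (suc dn) [] x (inj₂ p)
pushed-matched-or-stacked (d ∷ s) up dn (a ∷ st) x (inj₁ (here e)) = inj₁ (here e)
pushed-matched-or-stacked (d ∷ s) up dn (a ∷ st) x (inj₁ (there m)) with pushed-matched-or-stacked s up (suc dn) st x (inj₁ m)
... | inj₁ k = inj₁ (there k)
... | inj₂ k = inj₂ k
pushed-matched-or-stacked (d ∷ s) up dn (a ∷ st) x (inj₂ p) with pushed-matched-or-stacked s up (suc dn) st x (inj₂ p)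
... | inj₁ k = inj₁ (there k)
... | inj₂ k = inj₂ k

down-matched : ∀ {h s h'} → Path h s h' → ∀ up dn st → length st ≡ h → ∀ y → dn ≤ y → y < dn + nd s →
  ∃ λ c → (c , y) ∈ matchPairs s up dn st
down-matched pnil up dn st eq y l r = ⊥-elim (<-irrefl refl (≤-trans r (subst (_≤ y) (sym (+-identityʳ dn)) l)))
down-matched (pup p) up dn st eq y l r = down-matched p (up ∸ 1) dn (up ∷ st) (cong suc eq) y l r
down-matched (pdn p) up dn [] () y l r
down-matched {s = d ∷ s} (pdn p) up dn (a ∷ st) eq y l r with y ≟ dn
... | yes refl = a , here refl
... | no ne with down-matched p up (suc dn) st (suc-injective eq) y (≤∧≢⇒< l (λ e → ne (sym e))) (subst (y <_) (+-suc dn (nd s)) r)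
...   | c , m = c , there m

matched-up-unique : ∀ s up dn st {c c' y} → (c , y) ∈ matchPairs s up dn st → (c' , y) ∈ matchPairs s up dn st → c ≡ c'
matched-up-unique [] up dn st () m2
matched-up-unique (u ∷ s) up dn st m1 m2 = matched-up-unique s (up ∸ 1) dn (up ∷ st) m1 m2
matched-up-unique (d ∷ s) up dn [] m1 m2 = matched-up-unique s up (suc dn) [] m1 m2
matched-up-unique (d ∷ s) up dn (a ∷ st) (here refl) (here refl) = refl
matched-up-unique (d ∷ s) up dn (a ∷ st) (here refl) (there m2) = ⊥-elim (<-irrefl refl (proj₁ (values-range s up (suc dn) st m2)))
matched-up-unique (d ∷ s) up dn (a ∷ st) (there m1) (here refl) = ⊥-elim (<-irrefl refl (proj₁ (values-range s up (suc dn) st m1)))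
matched-up-unique (d ∷ s) up dn (a ∷ st) (there m1) (there m2) = matched-up-unique s up (suc dn) st m1 m2

Every-keys : ∀ {Q : ℕ → Set} (ps : List (ℕ × ℕ)) → Every (Q ∘ proj₁) ps → Every Q (map proj₁ ps)
Every-keys ps e m with ∈-map⁻ proj₁ m
... | p , mp , refl = e mp

labels-distinct : ∀ s up dn st → AllPairs _<_ st → Every (up <_) st → nu s ≤ up →
  AllPairs _≢_ (map proj₁ (matchPairs s up dn st) ++ stackAfter s up st)
labels-distinct [] up dn st so ab le = AllPairs-map st so
  where
  AllPairs-map : ∀ xs → AllPairs _<_ xs → AllPairs _≢_ xs
  AllPairs-map [] [] = []
  AllPairs-map (x ∷ xs) (a ∷ r) = All.map (λ lt e → <-irrefl e lt) a ∷ AllPairs-map xs r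
labels-distinct (u ∷ s) (suc up) dn st so ab (s≤s le) =
  labels-distinct s up dn (suc up ∷ st) (All.tabulate ab ∷ so) (Every-∷ ≤-refl (λ m → <-trans (n<1+n up) (ab m))) le
labels-distinct (d ∷ s) up dn [] so ab le = labels-distinct s up (suc dn) [] so ab le
labels-distinct (d ∷ s) up dn (a ∷ st) (ha ∷ so) ab le =
  All.tabulate (Every-++ (map proj₁ (matchPairs s up (suc dn) st)) (Every-keys (matchPairs s up (suc dn) st) (proj₁ a-fresh)) (proj₂ a-fresh))
  ∷ labels-distinct s up (suc dn) st so (ab ∘ there) le
  where
  a-fresh = keys-invariant (a ≢_) s up (suc dn) st (λ m → λ e → <-irrefl e (All.lookup ha m))
              (λ j _ e → <-irrefl (sym e) (≤-<-trans (m∸n≤m up j) (ab (here refl))))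

stack-sorted : ∀ s up st → AllPairs _<_ st → Every (up <_) st → nu s ≤ up → AllPairs _<_ (stackAfter s up st)
stack-sorted [] up st so ab le = so
stack-sorted (u ∷ s) (suc up) st so ab (s≤s le) =
  stack-sorted s up (suc up ∷ st) (All.tabulate ab ∷ so) (Every-∷ ≤-refl (λ m → <-trans (n<1+n up) (ab m))) le
stack-sorted (d ∷ s) up [] so ab le = stack-sorted s up [] so ab le
stack-sorted (d ∷ s) up (a ∷ st) (_ ∷ so) ab le = stack-sorted s up st so (ab ∘ there) le

nesting : ∀ s up dn st → AllPairs _<_ st → Every (up <_) st → nu s ≤ up → ∀ {x x' y y'} →
  x ∈ st → x' ∈ st → x < x' → (x , y) ∈ matchPairs s up dn st → (x' , y') ∈ matchPairs s up dn st → y < y'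
nesting [] up dn st so ab le mx mx' lt () m2
nesting (u ∷ s) (suc up) dn st so ab (s≤s le) mx mx' lt m1 m2 =
  nesting s up dn (suc up ∷ st) (All.tabulate ab ∷ so) (Every-∷ ≤-refl (λ m → <-trans (n<1+n up) (ab m))) le (there mx) (there mx') lt m1 m2
nesting (d ∷ s) up dn [] so ab le () mx' lt m1 m2
nesting (d ∷ s) up dn (a ∷ st) so ab le mx mx' lt (here refl) (here refl) = ⊥-elim (<-irrefl refl lt)
nesting (d ∷ s) up dn (a ∷ st) so ab le mx mx' lt (here refl) (there m2) = proj₁ (values-range s up (suc dn) st m2)
nesting (d ∷ s) up dn (a ∷ st) so ab le (here refl) mx' lt (there m1) (here refl) = ⊥-elim (<-irrefl refl lt)
nesting (d ∷ s) up dn (a ∷ st) (ha ∷ so) ab le (there mx) mx' lt (there m1) (here refl) =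
  ⊥-elim (<-asym lt (All.lookup ha mx))
nesting (d ∷ s) up dn (a ∷ st) so ab le mx mx' lt (there m1) (there m2) with labels-distinct (d ∷ s) up dn (a ∷ st) so ab le
nesting (d ∷ s) up dn (a ∷ st) so ab le (here refl) mx' lt (there m1) (there m2) | h ∷ _ =
  ⊥-elim (All.lookup h (∈-++⁺ˡ (∈-map⁺ proj₁ m1)) refl)
nesting (d ∷ s) up dn (a ∷ st) so ab le (there mx) (here refl) lt (there m1) (there m2) | h ∷ _ =
  ⊥-elim (All.lookup h (∈-++⁺ˡ (∈-map⁺ proj₁ m2)) refl)
nesting (d ∷ s) up dn (a ∷ st) (_ ∷ so) ab le (there mx) (there mx') lt (there m1) (there m2) | _ =
  nesting s up (suc dn) st so (ab ∘ there) le mx mx' lt m1 m2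

assoc-∈ : ∀ ps xs x y → AllPairs _≢_ (map proj₁ ps ++ xs) → (x , y) ∈ ps → assoc x ps ≡ y
assoc-∈ ((a , b) ∷ ps) xs x y up (here refl) rewrite ≡ᵇ-refl x = refl
assoc-∈ ((a , b) ∷ ps) xs x y (h ∷ up) (there m)
  rewrite ≢⇒≡ᵇ-false a x (All.lookup h (∈-++⁺ˡ (∈-map⁺ proj₁ m))) = assoc-∈ ps xs x y up m

assoc-∈⁻ : ∀ x ps → assoc x ps ≢ 0 → (x , assoc x ps) ∈ ps
assoc-∈⁻ x [] ne = ⊥-elim (ne refl)
assoc-∈⁻ x ((a , b) ∷ ps) ne with a ≡ᵇ x in eq
... | true rewrite ≡ᵇ-true⇒≡ a x eq = here refl
... | false = there (assoc-∈⁻ x ps ne)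

assoc-skip : ∀ x L M R → Every (λ p → proj₁ p ≢ x) M → assoc x (L ++ M ++ R) ≡ assoc x (L ++ R)
assoc-skip x [] [] R e = refl
assoc-skip x [] ((a , b) ∷ M) R e rewrite ≢⇒≡ᵇ-false a x (e (here refl)) = assoc-skip x [] M R (e ∘ there)
assoc-skip x ((a , b) ∷ L) M R e = cong (λ z → if a ≡ᵇ x then b else z) (assoc-skip x L M R e)

assoc-hit : ∀ x L R → x ∈ map proj₁ L → assoc x (L ++ R) ≡ assoc x L
assoc-hit x ((a , b) ∷ L) R m with a ≡ᵇ x in eq
... | true = refl
assoc-hit x ((a , b) ∷ L) R (here refl) | false rewrite ≡ᵇ-refl x with eq
... | ()
assoc-hit x ((a , b) ∷ L) R (there m) | false = assoc-hit x L R m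

assoc-map : ∀ (G H : ℕ → ℕ) → (∀ a b → G a ≡ G b → a ≡ b) → ∀ x ps →
  (x ∈ map proj₁ ps ⊎ H 0 ≡ 0) →
  assoc (G x) (map (λ p → G (proj₁ p) , H (proj₂ p)) ps) ≡ H (assoc x ps)
assoc-map G H inj x [] (inj₁ ())
assoc-map G H inj x [] (inj₂ e) = sym e
assoc-map G H inj x ((a , b) ∷ ps) c with a ≟ x
... | yes refl rewrite ≡ᵇ-refl (G a) | ≡ᵇ-refl a = refl
... | no ne rewrite ≢⇒≡ᵇ-false (G a) (G x) (λ e → ne (inj a x e)) | ≢⇒≡ᵇ-false a x ne =
  assoc-map G H inj x ps (drop-head c)
  where
  drop-head : (x ∈ map proj₁ ((a , b) ∷ ps) ⊎ H 0 ≡ 0) → (x ∈ map proj₁ ps ⊎ H 0 ≡ 0)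
  drop-head (inj₁ (here e)) = ⊥-elim (ne (sym e))
  drop-head (inj₁ (there m)) = inj₁ m
  drop-head (inj₂ e) = inj₂ e

mapKeys-∈ : ∀ (G H : ℕ → ℕ) x ps → x ∈ map proj₁ ps → G x ∈ map proj₁ (map (λ p → G (proj₁ p) , H (proj₂ p)) ps)
mapKeys-∈ G H x (p ∷ ps) (here refl) = here refl
mapKeys-∈ G H x (p ∷ ps) (there m) = there (mapKeys-∈ G H x ps m)

at-applyUpTo : ∀ (f : ℕ → ℕ) n i → i < n → at (applyUpTo f n) (suc i) ≡ f i
at-applyUpTo f (suc n) zero lt = refl
at-applyUpTo f (suc n) (suc i) (s≤s lt) = at-applyUpTo (f ∘ suc) n i lt

posOf-applyUpTo : ∀ (f : ℕ → ℕ) n a v → a < n → f a ≡ v → (∀ l → l < a → f l ≢ v) → posOf (applyUpTo f n) v ≡ suc a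
posOf-applyUpTo f (suc n) zero v lt e h rewrite e | ≡ᵇ-refl v = refl
posOf-applyUpTo f (suc n) (suc a) v (s≤s lt) e h
  rewrite ≢⇒≡ᵇ-false (f 0) v (h 0 (s≤s z≤n))
        | posOf-applyUpTo (f ∘ suc) n a v lt e (λ l l< → h (suc l) (s≤s l<)) = refl

posOf-applyUpTo-sound : ∀ (f : ℕ → ℕ) n v a → posOf (applyUpTo f n) v ≡ suc a → f a ≡ v
posOf-applyUpTo-sound f zero v a ()
posOf-applyUpTo-sound f (suc n) v a e with f 0 ≡ᵇ v in eq1
posOf-applyUpTo-sound f (suc n) v zero e | true = ≡ᵇ-true⇒≡ (f 0) v eq1
posOf-applyUpTo-sound f (suc n) v (suc a) () | true
posOf-applyUpTo-sound f (suc n) v a e | false with posOf (applyUpTo (f ∘ suc) n) v in eq2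
... | zero = ⊥-elim (0≢1+n e)
... | suc b rewrite sym (suc-injective e) = posOf-applyUpTo-sound (f ∘ suc) n v b eq2

inT? : (β : List ℕ) → (i : ℕ) → Dec (i < posOf β i × i < at β i)
inT? β i = (i <? posOf β i) ×-dec (i <? at β i)

|T|-count : ∀ (β : List ℕ) K a → length β ≡ K + a →
  (∀ i → i < K → suc i < posOf β (suc i) × suc i < at β (suc i)) →
  (∀ i → i < a → ¬ (suc (K + i) < posOf β (suc (K + i)) × suc (K + i) < at β (suc (K + i)))) →
  length (T β) ≡ K
|T|-count β K a eq inside outside = begin
  length (filter (inT? β) (range (length β)))
    ≡⟨ cong (λ n → length (filter (inT? β) (range n))) eq ⟩
  length (filter (inT? β) (range (K + a)))
    ≡⟨ cong (λ l → length (filter (inT? β) l)) (trans (map-applyUpTo id suc (K + a)) (applyUpTo-++ suc K a)) ⟩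
  length (filter (inT? β) (applyUpTo suc K ++ applyUpTo (λ i → suc (K + i)) a))
    ≡⟨ cong length (filter-++ (inT? β) (applyUpTo suc K) _) ⟩
  length (filter (inT? β) (applyUpTo suc K) ++ filter (inT? β) (applyUpTo (λ i → suc (K + i)) a))
    ≡⟨ cong₂ (λ x y → length (x ++ y)) (filter-all (inT? β) (All-applyUpTo suc K inside))
                                          (filter-none (inT? β) (All-applyUpTo (λ i → suc (K + i)) a outside)) ⟩
  length (applyUpTo suc K ++ [])
    ≡⟨ cong length (++-identityʳ (applyUpTo suc K)) ⟩
  length (applyUpTo suc K)
    ≡⟨ length-applyUpTo suc K ⟩
  K ∎
  where open ≡-Reasoning

⊗-unfold : ∀ α β K → length (T β) ≡ K →
  α ⊗ β ≡ take K (shiftFrom (suc K) (length α) β) ++ shift K α ++ drop K (shiftFrom (suc K) (length α) β)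
⊗-unfold α β K eq = cong (λ t → take t (shiftFrom (suc t) (length α) β) ++ shift t α ++ drop t (shiftFrom (suc t) (length α) β)) eq

Φinv-applyUpTo : ∀ D N → semilength D ≡ N → Φinv D ≡ applyUpTo (λ i → assoc (suc i) (matchPairs D N 1 [])) N
Φinv-applyUpTo D N eq = trans (cong (λ n → map (λ i → assoc i (matchPairs D n 1 [])) (range n)) eq)
                              (map-range (λ i → assoc i (matchPairs D N 1 [])) N)

dyck-all-matched : ∀ {s} → Path 0 s 0 → ∀ x → 0 < x → x ≤ nu s → x ∈ map proj₁ (matchPairs s (nu s) 1 [])
dyck-all-matched {s} p x pos le
  with pushed-matched-or-stacked s (nu s) 1 [] x (inj₂ (nu s ∸ x , ∸-monoʳ-< {m = nu s} {n = x} {o = 0} pos le , sym (m∸[m∸n]≡n le)))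
... | inj₁ m = m
... | inj₂ m = ⊥-elim (∉-length≡0 (stackAfter s (nu s) []) (stackAfter-length p (nu s) [] refl) m)

double-injective : ∀ m n → m + m ≡ n + n → m ≡ n
double-injective zero zero e = refl
double-injective (suc m) (suc n) e = cong suc (double-injective m n (suc-injective (trans (sym (+-suc m m)) (trans (suc-injective e) (+-suc n n)))))

-- Part (1): inserting a Dyck path D into the middle of A·B.
-- The map lift x = (x if x ≤ K, else x + m) is the relabelling β ↦ β^{(K+1)⋊m}.

module DyckInsertion (A B D : List Step) (h : ℕ) (pathA : Path 0 A h) (pathB : Path h B 0) (dyckD : Path 0 D 0)
          (equalLength : length A ≡ length B) where
  open ≡-Reasoning

  a K m s₁ N : ℕ
  a = nu A
  K = nd A
  m = nu D
  s₁ = K + a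
  N = K + (m + a)

  -- B has as many up-steps as A has down-steps: both halves have the same
  -- length and the height h is climbed by A and descended by B.
  nu-B≡K : nu B ≡ K
  nu-B≡K = sym (double-injective K (nu B) (+-cancelˡ-≡ h _ _ (begin
    h + (K + K) ≡⟨ sym (+-assoc h K K) ⟩
    h + K + K ≡⟨ cong (_+ K) (sym (path-balance pathA)) ⟩
    a + K ≡⟨ sym (length≡nu+nd A) ⟩
    length A ≡⟨ equalLength ⟩
    length B ≡⟨ length≡nu+nd B ⟩
    nu B + nd B ≡⟨ cong (nu B +_) (sym (path-balance pathB)) ⟩
    nu B + (h + nu B) ≡⟨ sym (+-assoc (nu B) h (nu B)) ⟩
    nu B + h + nu B ≡⟨ cong (_+ nu B) (+-comm (nu B) h) ⟩
    h + nu B + nu B ≡⟨ +-assoc h (nu B) (nu B) ⟩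
    h + (nu B + nu B) ∎)))

  nd-D≡m : nd D ≡ m
  nd-D≡m = sym (path-balance dyckD)

  nu-AB : nu (A ++ B) ≡ s₁
  nu-AB = trans (nu-++ A B) (trans (cong (a +_) nu-B≡K) (+-comm a K))

  semilength-ADB : semilength (A ++ D ++ B) ≡ N
  semilength-ADB = begin
    semilength (A ++ D ++ B) ≡⟨ semilength≡nu (A ++ D ++ B) ⟩
    nu (A ++ D ++ B) ≡⟨ nu-++ A (D ++ B) ⟩
    a + nu (D ++ B) ≡⟨ cong (a +_) (nu-++ D B) ⟩
    a + (m + nu B) ≡⟨ cong (λ z → a + (m + z)) nu-B≡K ⟩
    a + (m + K) ≡⟨ +-comm a _ ⟩
    m + K + a ≡⟨ cong (_+ a) (+-comm m K) ⟩
    K + m + a ≡⟨ +-assoc K m a ⟩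
    N ∎

  s₁+m≡N : s₁ + m ≡ N
  s₁+m≡N = trans (+-assoc K a m) (cong (K +_) (+-comm a m))

  matchA stackA matchB matchD matchAB : _
  matchA = matchPairs A s₁ 1 []
  stackA = stackAfter A s₁ []
  matchB = matchPairs B K (suc K) stackA
  matchD = matchPairs D m 1 []
  matchAB = matchPairs (A ++ B) s₁ 1 []

  matchAB-split : matchAB ≡ matchA ++ matchB
  matchAB-split = trans (matchPairs-++ A B s₁ 1 []) (cong (λ z → matchA ++ matchPairs B z (suc K) stackA) (m+n∸n≡m K a))

  lift : ℕ → ℕ
  lift x = if x <ᵇ suc K then x else x + m

  lift-low : ∀ x → x ≤ K → lift x ≡ x
  lift-low x le rewrite <⇒<ᵇ-true x (suc K) (s≤s le) = refl

  lift-high : ∀ x → K < x → lift x ≡ x + m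
  lift-high x lt rewrite ≥⇒<ᵇ-false x (suc K) lt = refl

  lift-injective : ∀ x y → lift x ≡ lift y → x ≡ y
  lift-injective x y e with x ≤? K | y ≤? K
  ... | yes lx | yes ly = trans (sym (lift-low x lx)) (trans e (lift-low y ly))
  ... | no lx | no ly = +-cancelʳ-≡ m x y (trans (sym (lift-high x (≰⇒> lx))) (trans e (lift-high y (≰⇒> ly))))
  ... | yes lx | no ly = ⊥-elim (<⇒≱ (≰⇒> ly) (≤-trans (m≤m+n y m) (≤-trans (≤-reflexive (trans (sym (lift-high y (≰⇒> ly))) (trans (sym e) (lift-low x lx)))) lx)))
  ... | no lx | yes ly = ⊥-elim (<⇒≱ (≰⇒> lx) (≤-trans (m≤m+n x m) (≤-trans (≤-reflexive (trans (sym (lift-high x (≰⇒> lx))) (trans e (lift-low y ly)))) ly)))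

  pushedA-range : ∀ j → j < a → K < s₁ ∸ j × s₁ ∸ j ≤ s₁
  pushedA-range j lt = subst (K <_) (sym (+-∸-assoc K (<⇒≤ lt))) (m<m+n K (m<n⇒0<n∸m lt)) , m∸n≤m s₁ j

  keysA : Every (λ p → K < proj₁ p × proj₁ p ≤ s₁) matchA
  keysA = proj₁ (keys-invariant (λ c → K < c × c ≤ s₁) A s₁ 1 [] (λ ()) pushedA-range)

  stackA-high : Every (K <_) stackA
  stackA-high x∈ = proj₁ (proj₂ (keys-invariant (λ c → K < c × c ≤ s₁) A s₁ 1 [] (λ ()) pushedA-range) x∈)

  stackA-sorted : AllPairs _<_ stackA
  stackA-sorted = stack-sorted A s₁ [] [] (λ ()) (m≤n+m a K)

  valuesA : Every (λ p → 1 ≤ proj₂ p × proj₂ p < 1 + K) matchA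
  valuesA = values-range A s₁ 1 []

  valuesB : Every (λ p → suc K ≤ proj₂ p × proj₂ p < suc K + nd B) matchB
  valuesB = values-range B K (suc K) stackA

  keysB : Every (λ p → proj₁ p ∈ stackA ⊎ proj₁ p ≤ K) matchB
  keysB = proj₁ (keys-invariant (λ z → z ∈ stackA ⊎ z ≤ K) B K (suc K) stackA inj₁ (λ j _ → inj₂ (m∸n≤m K j)))

  keysD : Every (λ p → 1 ≤ proj₁ p × proj₁ p ≤ m) matchD
  keysD = proj₁ (keys-invariant (λ c → 1 ≤ c × c ≤ m) D m 1 [] (λ ()) (λ j lt → m<n⇒0<n∸m lt , m∸n≤m m j))

  -- The matching of A·D·B: A relabelled by +m, then D relabelled by +K
  -- (it only sees the empty frame above A's stack), then B relabelled by lift.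

  stackA↑ : List ℕ
  stackA↑ = map (_+ m) stackA

  matchA↑ matchD↑ matchB↑ : List (ℕ × ℕ)
  matchA↑ = map (relabelPair (_+ m) 0) matchA
  matchD↑ = map (relabelPair (_+ K) K) matchD
  matchB↑ = map (relabelPair lift m) matchB

  shiftedA-labels : ∀ j → j < nu A → (s₁ ∸ j) + m ≡ (s₁ + m) ∸ j
  shiftedA-labels j lt = sym (+-∸-comm m (≤-trans (<⇒≤ lt) (m≤n+m a K)))

  matchA-in-ADB : matchPairs A N 1 [] ≡ matchA↑
  matchA-in-ADB = subst (λ z → matchPairs A z 1 [] ≡ matchA↑) s₁+m≡N
    (matchPairs-relabel (_+ m) 0 A s₁ (s₁ + m) 1 [] shiftedA-labels)

  stackA-in-ADB : stackAfter A N [] ≡ stackA↑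
  stackA-in-ADB = subst (λ z → stackAfter A z [] ≡ stackA↑) s₁+m≡N (stackAfter-relabel (_+ m) A s₁ (s₁ + m) [] shiftedA-labels)

  N∸a : N ∸ a ≡ K + m
  N∸a = begin
    N ∸ a ≡⟨ cong (_∸ a) (sym (+-assoc K m a)) ⟩
    K + m + a ∸ a ≡⟨ m+n∸n≡m (K + m) a ⟩
    K + m ∎

  shiftedD-labels : ∀ j → j < nu D → (m ∸ j) + K ≡ (K + m) ∸ j
  shiftedD-labels j lt = trans (+-comm (m ∸ j) K) (sym (+-∸-assoc K (<⇒≤ lt)))

  matchD-in-ADB : matchPairs D (K + m) (suc K) stackA↑ ≡ matchD↑
  matchD-in-ADB = trans (matchPairs-frame dyckD (K + m) (suc K) [] stackA↑ refl) (matchPairs-relabel (_+ K) K D m (K + m) 1 [] shiftedD-labels)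

  stackD-in-ADB : stackAfter D (K + m) stackA↑ ≡ stackA↑
  stackD-in-ADB = trans (stackAfter-frame dyckD (K + m) [] stackA↑ refl) (cong (_++ stackA↑) (length≡0⇒[] _ (stackAfter-length dyckD (K + m) [] refl)))

  stackA↑≡lift : stackA↑ ≡ map lift stackA
  stackA↑≡lift = map-cong-Every stackA (λ x∈ → sym (lift-high _ (stackA-high x∈)))

  matchB-in-ADB : matchPairs B ((K + m) ∸ nu D) (suc K + nd D) (stackAfter D (K + m) stackA↑) ≡ matchB↑
  matchB-in-ADB = begin
    matchPairs B ((K + m) ∸ nu D) (suc K + nd D) (stackAfter D (K + m) stackA↑)
      ≡⟨ cong₂ (λ x y → matchPairs B x (suc K + y) (stackAfter D (K + m) stackA↑)) (m+n∸n≡m K m) nd-D≡m ⟩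
    matchPairs B K (suc K + m) (stackAfter D (K + m) stackA↑)
      ≡⟨ cong (matchPairs B K (suc K + m)) (trans stackD-in-ADB stackA↑≡lift) ⟩
    matchPairs B K (suc K + m) (map lift stackA)
      ≡⟨ matchPairs-relabel lift m B K K (suc K) stackA (λ j _ → lift-low (K ∸ j) (m∸n≤m K j)) ⟩
    matchB↑ ∎

  matchADB-split : matchPairs (A ++ D ++ B) N 1 [] ≡ matchA↑ ++ matchD↑ ++ matchB↑
  matchADB-split = begin
    matchPairs (A ++ D ++ B) N 1 []
      ≡⟨ matchPairs-++ A (D ++ B) N 1 [] ⟩
    matchPairs A N 1 [] ++ matchPairs (D ++ B) (N ∸ a) (1 + K) (stackAfter A N [])
      ≡⟨ cong₂ _++_ matchA-in-ADB (cong₂ (λ x y → matchPairs (D ++ B) x (suc K) y) N∸a stackA-in-ADB) ⟩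
    matchA↑ ++ matchPairs (D ++ B) (K + m) (suc K) stackA↑
      ≡⟨ cong (matchA↑ ++_) (matchPairs-++ D B (K + m) (suc K) stackA↑) ⟩
    matchA↑ ++ (matchPairs D (K + m) (suc K) stackA↑ ++ matchPairs B ((K + m) ∸ nu D) (suc K + nd D) (stackAfter D (K + m) stackA↑))
      ≡⟨ cong (matchA↑ ++_) (cong₂ _++_ matchD-in-ADB matchB-in-ADB) ⟩
    matchA↑ ++ matchD↑ ++ matchB↑ ∎

  βAt : ℕ → ℕ
  βAt i = assoc (suc i) matchAB

  β α : List ℕ
  β = applyUpTo βAt s₁
  α = applyUpTo (λ i → assoc (suc i) matchD) m

  β≡ : Φinv (A ++ B) ≡ β
  β≡ = Φinv-applyUpTo (A ++ B) s₁ (trans (semilength≡nu (A ++ B)) nu-AB)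

  α≡ : Φinv D ≡ α
  α≡ = Φinv-applyUpTo D m (semilength≡nu D)

  assocAB : ∀ {x y} → (x , y) ∈ matchAB → assoc x matchAB ≡ y
  assocAB {x} {y} = assoc-∈ matchAB _ x y (labels-distinct (A ++ B) s₁ 1 [] [] (λ ()) (≤-reflexive nu-AB))

  matchedAB : ∀ x → 0 < x → x ≤ s₁ → x ∈ map proj₁ matchAB
  matchedAB x pos le = subst (λ z → x ∈ map proj₁ (matchPairs (A ++ B) z 1 [])) nu-AB
    (dyck-all-matched (path-++ pathA pathB) x pos (subst (x ≤_) (sym nu-AB) le))

  matchAB-parts : ∀ {q} → q ∈ matchAB → q ∈ matchA ⊎ q ∈ matchB
  matchAB-parts q∈ = ∈-++⁻ matchA (subst (_ ∈_) matchAB-split q∈)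

  nonzero : ∀ {x y} → x < y → y ≢ 0
  nonzero lt refl with lt
  ... | ()

  -- T(β) ⊇ {1, …, K}: the down-step i ≤ K lies in A and is matched with an
  -- up-label c > K of A (so β⁻¹(i) = c > i), while the up-step labelled i
  -- lies in B and is matched with a down-step of B (so β(i) > K ≥ i).
  T-initial : ∀ i → i < K → suc i < posOf β (suc i) × suc i < at β (suc i)
  T-initial i lt with ∈-map⁻ proj₁ (matchedAB (suc i) (s≤s z≤n) (≤-trans lt (m≤m+n K a)))
  ... | (_ , y) , i∈ , refl = position , value
    where
    y-in-B : suc K ≤ y
    y-in-B with matchAB-parts i∈
    ... | inj₁ inA = ⊥-elim (<⇒≱ (proj₁ (keysA inA)) lt)
    ... | inj₂ inB = proj₁ (valuesB inB)
    value : suc i < at β (suc i)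
    value rewrite at-applyUpTo βAt s₁ i (≤-trans lt (m≤m+n K a)) | assocAB i∈ = <-≤-trans (s≤s lt) y-in-B
    position : suc i < posOf β (suc i)
    position with down-matched pathA s₁ 1 [] refl (suc i) (s≤s z≤n) (s≤s lt)
    ... | zero , c∈ = ⊥-elim (<⇒≱ (proj₁ (keysA c∈)) z≤n)
    ... | suc c , c∈ = subst (suc i <_) (sym pos≡) (<-≤-trans (s≤s lt) (proj₁ (keysA c∈)))
      where
      c∈AB : (suc c , suc i) ∈ matchAB
      c∈AB = subst (_ ∈_) (sym matchAB-split) (∈-++⁺ˡ c∈)
      pos≡ : posOf β (suc i) ≡ suc c
      pos≡ = posOf-applyUpTo βAt s₁ c (suc i) (proj₂ (keysA c∈)) (assocAB c∈AB)
        (λ l l< e → <-irrefl (suc-injective (matched-up-unique (A ++ B) s₁ 1 []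
             (subst (λ z → (suc l , z) ∈ matchAB) e (assoc-∈⁻ (suc l) matchAB (λ e0 → nonzero (s≤s z≤n) (trans (sym e) e0)))) c∈AB)) l<)

  -- T(β) ∩ {K+1, …, s₁} = ∅: for x > K both x and β⁻¹(x) > x would be labels
  -- left on A's stack and matched in B; nesting then forces β(x) < x.
  T-final : ∀ i → i < a → ¬ (suc (K + i) < posOf β (suc (K + i)) × suc (K + i) < at β (suc (K + i)))
  T-final i lt (x<pos , x<val) with posOf β (suc (K + i)) in pos≡
  ... | zero with x<pos
  ...   | ()
  T-final i lt (x<pos , x<val) | suc c =
    <-asym x<val (nesting B K (suc K) stackA stackA-sorted stackA-high (≤-reflexive nu-B≡K) x∈stackA c∈stackA x<pos x∈B c∈B)
    where
    x = suc (K + i)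
    x-low : K < x
    x-low = s≤s (m≤m+n K i)
    val≡ : at β x ≡ assoc x matchAB
    val≡ = at-applyUpTo βAt s₁ (K + i) (+-monoʳ-< K lt)
    x∈AB : (x , at β x) ∈ matchAB
    x∈AB = subst (λ z → (x , z) ∈ matchAB) (sym val≡) (assoc-∈⁻ x matchAB (nonzero (subst (x <_) val≡ x<val)))
    c↦x : assoc (suc c) matchAB ≡ x
    c↦x = posOf-applyUpTo-sound βAt s₁ x c pos≡
    c∈AB : (suc c , x) ∈ matchAB
    c∈AB = subst (λ z → (suc c , z) ∈ matchAB) c↦x (assoc-∈⁻ (suc c) matchAB (λ e → nonzero (s≤s z≤n) (trans (sym c↦x) e)))
    x∈B : (x , at β x) ∈ matchB
    x∈B with matchAB-parts x∈AB
    ... | inj₁ inA = ⊥-elim (<⇒≱ (proj₂ (valuesA inA)) (<-trans x-low x<val))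
    ... | inj₂ inB = inB
    c∈B : (suc c , x) ∈ matchB
    c∈B with matchAB-parts c∈AB
    ... | inj₁ inA = ⊥-elim (<⇒≱ (proj₂ (valuesA inA)) x-low)
    ... | inj₂ inB = inB
    x∈stackA : x ∈ stackA
    x∈stackA with keysB x∈B
    ... | inj₁ s∈ = s∈
    ... | inj₂ le = ⊥-elim (<⇒≱ x-low le)
    c∈stackA : suc c ∈ stackA
    c∈stackA with keysB c∈B
    ... | inj₁ s∈ = s∈
    ... | inj₂ le = ⊥-elim (<⇒≱ (<-trans x-low x<pos) le)

  |T-β|≡K : length (T β) ≡ K
  |T-β|≡K = |T|-count β K a (length-applyUpTo βAt s₁) T-initial T-final

  liftPair : ℕ × ℕ → ℕ × ℕ
  liftPair p = lift (proj₁ p) , lift (proj₂ p)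

  outer-lifted : matchA↑ ++ matchB↑ ≡ map liftPair matchAB
  outer-lifted = begin
    matchA↑ ++ matchB↑
      ≡⟨ cong₂ _++_ (map-cong-Every matchA (λ p∈ → cong₂ _,_ (sym (lift-high _ (proj₁ (keysA p∈))))
                                                          (trans (+-identityʳ _) (sym (lift-low _ (s≤s⁻¹ (proj₂ (valuesA p∈))))))))
                    (map-cong-Every matchB (λ {p} p∈ → cong (lift (proj₁ p) ,_) (sym (lift-high _ (proj₁ (valuesB p∈)))))) ⟩
    map liftPair matchA ++ map liftPair matchB ≡⟨ sym (map-++ liftPair matchA matchB) ⟩
    map liftPair (matchA ++ matchB) ≡⟨ cong (map liftPair) (sym matchAB-split) ⟩
    map liftPair matchAB ∎

  keysD↑ : Every (λ p → K < proj₁ p × proj₁ p ≤ m + K) matchD↑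
  keysD↑ p∈ with ∈-map⁻ (relabelPair (_+ K) K) p∈
  ... | q , q∈ , refl = subst (_< proj₁ q + K) (+-identityˡ K) (+-monoˡ-< K (proj₁ (keysD q∈))) , +-monoˡ-≤ K (proj₂ (keysD q∈))

  keysA↑ : Every (λ p → suc (K + m) ≤ proj₁ p) matchA↑
  keysA↑ p∈ with ∈-map⁻ (relabelPair (_+ m) 0) p∈
  ... | q , q∈ , refl = +-monoˡ-≤ m (proj₁ (keysA q∈))

  assoc-outer : ∀ x → Every (λ p → proj₁ p ≢ lift x) matchD↑ → assoc (lift x) (matchA↑ ++ matchD↑ ++ matchB↑) ≡ lift (assoc x matchAB)
  assoc-outer x avoidsD = begin
    assoc (lift x) (matchA↑ ++ matchD↑ ++ matchB↑) ≡⟨ assoc-skip (lift x) matchA↑ matchD↑ matchB↑ avoidsD ⟩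
    assoc (lift x) (matchA↑ ++ matchB↑) ≡⟨ cong (assoc (lift x)) outer-lifted ⟩
    assoc (lift x) (map liftPair matchAB) ≡⟨ assoc-map lift lift lift-injective x matchAB (inj₂ refl) ⟩
    lift (assoc x matchAB) ∎

  ADB : ℕ → ℕ
  ADB i = assoc (suc i) (matchA↑ ++ matchD↑ ++ matchB↑)

  ADB-initial : ∀ i → i < K → ADB i ≡ lift (βAt i)
  ADB-initial i lt = trans (cong (λ z → assoc z (matchA↑ ++ matchD↑ ++ matchB↑)) (sym (lift-low (suc i) lt)))
    (assoc-outer (suc i) (λ p∈ e → <⇒≱ (proj₁ (keysD↑ p∈)) (≤-trans (≤-reflexive e) (≤-trans (≤-reflexive (lift-low (suc i) lt)) lt))))

  ADB-middle : ∀ i → i < m → ADB (K + i) ≡ assoc (suc i) matchD + K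
  ADB-middle i lt = begin
    assoc (suc (K + i)) (matchA↑ ++ matchD↑ ++ matchB↑) ≡⟨ assoc-skip (suc (K + i)) [] matchA↑ (matchD↑ ++ matchB↑)
        (λ p∈ e → <⇒≱ (s≤s (+-monoʳ-< K lt)) (≤-trans (keysA↑ p∈) (≤-reflexive e))) ⟩
    assoc (suc (K + i)) (matchD↑ ++ matchB↑) ≡⟨ assoc-hit _ matchD↑ matchB↑ (subst (_∈ map proj₁ matchD↑) (sym x≡) (mapKeys-∈ (_+ K) (_+ K) (suc i) matchD i∈D)) ⟩
    assoc (suc (K + i)) matchD↑ ≡⟨ cong (λ z → assoc z matchD↑) x≡ ⟩
    assoc (suc i + K) matchD↑ ≡⟨ assoc-map (_+ K) (_+ K) (λ x y e → +-cancelʳ-≡ K x y e) (suc i) matchD (inj₁ i∈D) ⟩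
    assoc (suc i) matchD + K ∎
    where
    x≡ : suc (K + i) ≡ suc i + K
    x≡ = cong suc (+-comm K i)
    i∈D : suc i ∈ map proj₁ matchD
    i∈D = dyck-all-matched dyckD (suc i) (s≤s z≤n) lt

  ADB-final : ∀ i → i < a → ADB (K + (m + i)) ≡ lift (βAt (K + i))
  ADB-final i lt = trans (cong (λ z → assoc z (matchA↑ ++ matchD↑ ++ matchB↑)) (sym lifted))
    (assoc-outer (suc (K + i)) (λ p∈ e → <⇒≱ (s≤s (≤-trans (proj₂ (keysD↑ p∈)) (≤-trans (≤-reflexive (+-comm m K)) (+-monoʳ-≤ K (m≤m+n m i)))))
       (≤-reflexive (trans (sym lifted) (sym e)))))
    where
    lifted : lift (suc (K + i)) ≡ suc (K + (m + i))
    lifted = trans (lift-high _ (s≤s (m≤m+n K i))) (cong suc (trans (+-assoc K i m) (cong (K +_) (+-comm i m))))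

  β-initial : take K (shiftFrom (suc K) m β) ≡ applyUpTo (lift ∘ βAt) K
  β-initial = trans (cong (take K) (map-applyUpTo βAt lift s₁)) (take-applyUpTo (lift ∘ βAt) K a)

  β-final : drop K (shiftFrom (suc K) m β) ≡ applyUpTo (λ i → lift (βAt (K + i))) a
  β-final = trans (cong (drop K) (map-applyUpTo βAt lift s₁)) (drop-applyUpTo (lift ∘ βAt) K a)

  α-shifted : shift K α ≡ applyUpTo (λ i → assoc (suc i) matchD + K) m
  α-shifted = map-applyUpTo (λ i → assoc (suc i) matchD) (_+ K) m

  Φinv-ADB : Φinv (A ++ D ++ B) ≡ Φinv D ⊗ Φinv (A ++ B)
  Φinv-ADB = begin
    Φinv (A ++ D ++ B) ≡⟨ Φinv-applyUpTo (A ++ D ++ B) N semilength-ADB ⟩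
    applyUpTo (λ i → assoc (suc i) (matchPairs (A ++ D ++ B) N 1 [])) N
      ≡⟨ cong (λ ps → applyUpTo (λ i → assoc (suc i) ps) N) matchADB-split ⟩
    applyUpTo ADB N ≡⟨ applyUpTo-++ ADB K (m + a) ⟩
    applyUpTo ADB K ++ applyUpTo (λ i → ADB (K + i)) (m + a)
      ≡⟨ cong (applyUpTo ADB K ++_) (applyUpTo-++ (λ i → ADB (K + i)) m a) ⟩
    applyUpTo ADB K ++ applyUpTo (λ i → ADB (K + i)) m ++ applyUpTo (λ i → ADB (K + (m + i))) a
      ≡⟨ cong₂ _++_ (applyUpTo-cong _ _ K ADB-initial) (cong₂ _++_ (applyUpTo-cong _ _ m ADB-middle) (applyUpTo-cong _ _ a ADB-final)) ⟩
    applyUpTo (lift ∘ βAt) K ++ applyUpTo (λ i → assoc (suc i) matchD + K) m ++ applyUpTo (λ i → lift (βAt (K + i))) a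
      ≡⟨ sym (cong₂ _++_ β-initial (cong₂ _++_ α-shifted β-final)) ⟩
    take K (shiftFrom (suc K) m β) ++ shift K α ++ drop K (shiftFrom (suc K) m β)
      ≡⟨ cong (λ l → take K (shiftFrom (suc K) l β) ++ shift K α ++ drop K (shiftFrom (suc K) l β)) (sym (length-applyUpTo _ m)) ⟩
    take K (shiftFrom (suc K) (length α) β) ++ shift K α ++ drop K (shiftFrom (suc K) (length α) β)
      ≡⟨ sym (⊗-unfold α β K |T-β|≡K) ⟩
    α ⊗ β ≡⟨ sym (cong₂ _⊗_ α≡ β≡) ⟩
    Φinv D ⊗ Φinv (A ++ B) ∎

Φinv-insert : ∀ A B D h → Path 0 A h → Path h B 0 → Path 0 D 0 → length A ≡ length B →
  Φinv (A ++ D ++ B) ≡ Φinv D ⊗ Φinv (A ++ B)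
Φinv-insert A B D h pathA pathB dyckD equalLength = DyckInsertion.Φinv-ADB A B D h pathA pathB dyckD equalLength

-- Part (2): RSK and Ψ of a direct sum.

AllEntries : (ℕ → Set) → Tableau → Set
AllEntries Pr P = Every (Every Pr) P

OnBumped : (ℕ → Set) → Maybe ℕ → Set
OnBumped Pr nothing = ⊤
OnBumped Pr (just y) = Pr y

insertRow-preserves : ∀ (Pr : ℕ → Set) x r → Pr x → Every Pr r → Every Pr (proj₂ (insertRow x r)) × OnBumped Pr (proj₁ (insertRow x r))
insertRow-preserves Pr x [] px er = Every-∷ {Q = Pr} px (λ ()) , tt
insertRow-preserves Pr x (y ∷ ys) px er with x <ᵇ y
... | true = Every-∷ px (Every-tail er) , er (here refl)
... | false with insertRow x ys | insertRow-preserves Pr x ys px (Every-tail er)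
...   | b , r | (e1 , e2) = Every-∷ (er (here refl)) e1 , e2

insertTab-preserves : ∀ (Pr : ℕ → Set) x P → Pr x → AllEntries Pr P → AllEntries Pr (proj₁ (insertTab x P))
insertTab-preserves Pr x [] px ar = Every-∷ {Q = Every Pr} (Every-∷ {Q = Pr} px (λ ())) (λ ())
insertTab-preserves Pr x (r ∷ rs) px ar with insertRow x r | insertRow-preserves Pr x r px (ar (here refl))
... | nothing , r' | (er , _) = Every-∷ {Q = Every Pr} er (Every-tail ar)
... | just y , r' | (er , py) with insertTab y rs | insertTab-preserves Pr y rs py (Every-tail ar)
...   | rs' , k | ih = Every-∷ {Q = Every Pr} er ih

addAt-preserves : ∀ (Pr : ℕ → Set) i k Q → Pr i → AllEntries Pr Q → AllEntries Pr (addAt i k Q)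
addAt-preserves Pr i _ [] pi aq = Every-∷ {Q = Every Pr} (Every-∷ {Q = Pr} pi (λ ())) (λ ())
addAt-preserves Pr i zero (r ∷ rs) pi aq = Every-∷ {Q = Every Pr} (Every-++ r (aq (here refl)) (Every-∷ {Q = Pr} pi (λ ()))) (Every-tail aq)
addAt-preserves Pr i (suc k) (r ∷ rs) pi aq = Every-∷ {Q = Every Pr} (aq (here refl)) (addAt-preserves Pr i k rs pi (Every-tail aq))

rskFrom-++ : ∀ i xs ys PQ → rskFrom i (xs ++ ys) PQ ≡ rskFrom (i + length xs) ys (rskFrom i xs PQ)
rskFrom-++ i [] ys PQ = cong (λ z → rskFrom z ys PQ) (sym (+-identityʳ i))
rskFrom-++ i (x ∷ xs) ys (P , Q) with insertTab x P
... | P' , k = trans (rskFrom-++ (suc i) xs ys (P' , addAt i k Q)) (cong (λ z → rskFrom z ys (rskFrom (suc i) xs (P' , addAt i k Q))) (sym (+-suc i (length xs))))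

shiftTab : ℕ → Tableau → Tableau
shiftTab c = map (map (_+ c))

<ᵇ-+ : ∀ x y c → (x + c <ᵇ y + c) ≡ (x <ᵇ y)
<ᵇ-+ x y zero rewrite +-identityʳ x | +-identityʳ y = refl
<ᵇ-+ x y (suc c) rewrite +-suc x c | +-suc y c = <ᵇ-+ x y c

insertRow-shift : ∀ c x r → insertRow (x + c) (map (_+ c) r) ≡ (Maybe.map (_+ c) (proj₁ (insertRow x r)) , map (_+ c) (proj₂ (insertRow x r)))
insertRow-shift c x [] = refl
insertRow-shift c x (y ∷ ys) rewrite <ᵇ-+ x y c with x <ᵇ y
... | true = refl
... | false with insertRow x ys | insertRow-shift c x ys
...   | b , r | ih rewrite ih = refl

insertTab-shift : ∀ c x P → insertTab (x + c) (shiftTab c P) ≡ (shiftTab c (proj₁ (insertTab x P)) , proj₂ (insertTab x P))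
insertTab-shift c x [] = refl
insertTab-shift c x (r ∷ rs) rewrite insertRow-shift c x r with insertRow x r
... | nothing , r' = refl
... | just y , r' with insertTab y rs | insertTab-shift c y rs
...   | rs' , k | ih rewrite ih = refl

addAt-shift : ∀ i c k Q → addAt (i + c) k (shiftTab c Q) ≡ shiftTab c (addAt i k Q)
addAt-shift i c k [] = refl
addAt-shift i c zero (r ∷ rs) = cong (_∷ shiftTab c rs) (sym (map-++ (_+ c) r (i ∷ [])))
addAt-shift i c (suc k) (r ∷ rs) = cong (map (_+ c) r ∷_) (addAt-shift i c k rs)

rskFrom-shift : ∀ i c xs P Q → rskFrom (i + c) (map (_+ c) xs) (shiftTab c P , shiftTab c Q) ≡
  (shiftTab c (proj₁ (rskFrom i xs (P , Q))) , shiftTab c (proj₂ (rskFrom i xs (P , Q))))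
rskFrom-shift i c [] P Q = refl
rskFrom-shift i c (x ∷ xs) P Q rewrite insertTab-shift c x P with insertTab x P
... | P' , k rewrite addAt-shift i c k Q = rskFrom-shift (suc i) c xs P' (addAt i k Q)

-- If every entry of P₁ is ≤ c and all further
-- inputs are > c, inserting them into glue P₁ P₂ only affects the P₂ part:
-- each new entry passes over the P₁ part of a row and bumps within P₂.
glue : Tableau → Tableau → Tableau
glue [] ys = ys
glue (x ∷ xs) [] = x ∷ xs
glue (x ∷ xs) (y ∷ ys) = (x ++ y) ∷ glue xs ys

glue-[] : ∀ xs → glue xs [] ≡ xs
glue-[] [] = refl
glue-[] (x ∷ xs) = refl

insertRow-append : ∀ x r → Every (_≤ x) r → insertRow x r ≡ (nothing , r ++ x ∷ [])
insertRow-append x [] e = refl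
insertRow-append x (y ∷ ys) e rewrite ≥⇒<ᵇ-false x y (e (here refl)) | insertRow-append x ys (Every-tail e) = refl

insertRow-glue : ∀ x r1 r2 → Every (_≤ x) r1 → insertRow x (r1 ++ r2) ≡ (proj₁ (insertRow x r2) , r1 ++ proj₂ (insertRow x r2))
insertRow-glue x [] r2 e = refl
insertRow-glue x (y ∷ r1) r2 e rewrite ≥⇒<ᵇ-false x y (e (here refl)) | insertRow-glue x r1 r2 (Every-tail e) = refl

bumped-∈ : ∀ x r {y r'} → insertRow x r ≡ (just y , r') → y ∈ r
bumped-∈ x [] ()
bumped-∈ x (z ∷ zs) eq with x <ᵇ z
bumped-∈ x (z ∷ zs) refl | true = here refl
... | false with insertRow x zs in e2
bumped-∈ x (z ∷ zs) refl | false | just y , r = there (bumped-∈ x zs e2)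

insertTab-glue : ∀ c x P1 P2 → c < x → AllEntries (_≤ c) P1 → AllEntries (c <_) P2 →
  insertTab x (glue P1 P2) ≡ (glue P1 (proj₁ (insertTab x P2)) , proj₂ (insertTab x P2))
insertTab-glue c x [] P2 lt a1 a2 = refl
insertTab-glue c x (r1 ∷ P1) [] lt a1 a2
  rewrite insertRow-append x r1 (λ m → ≤-trans (a1 (here refl) m) (<⇒≤ lt)) | glue-[] P1 = refl
insertTab-glue c x (r1 ∷ P1) (r2 ∷ P2) lt a1 a2
  rewrite insertRow-glue x r1 r2 (λ m → ≤-trans (a1 (here refl) m) (<⇒≤ lt)) with insertRow x r2 in e
... | nothing , r2' = refl
... | just y , r2' with insertTab y (glue P1 P2) | insertTab-glue c y P1 P2 (a2 (here refl) (bumped-∈ x r2 e)) (Every-tail a1) (Every-tail a2)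
...   | t | ih rewrite ih with insertTab y P2
...     | P2' , k = refl

addAt-glue : ∀ i k Q1 Q2 → k ≤ length Q2 → addAt i k (glue Q1 Q2) ≡ glue Q1 (addAt i k Q2)
addAt-glue i k [] Q2 le = refl
addAt-glue i zero (r1 ∷ Q1) [] le = cong ((r1 ++ i ∷ []) ∷_) (sym (glue-[] Q1))
addAt-glue i (suc k) (r1 ∷ Q1) [] ()
addAt-glue i zero (r1 ∷ Q1) (r2 ∷ Q2) le = cong (_∷ glue Q1 Q2) (++-assoc r1 r2 (i ∷ []))
addAt-glue i (suc k) (r1 ∷ Q1) (r2 ∷ Q2) (s≤s le) = cong ((r1 ++ r2) ∷_) (addAt-glue i k Q1 Q2 le)

insertTab-shape : ∀ x i P Q → length P ≡ length Q →
  proj₂ (insertTab x P) ≤ length P × length (proj₁ (insertTab x P)) ≡ length (addAt i (proj₂ (insertTab x P)) Q)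
insertTab-shape x i [] [] eq = z≤n , refl
insertTab-shape x i [] (q ∷ Q) ()
insertTab-shape x i (r ∷ P) [] ()
insertTab-shape x i (r ∷ P) (q ∷ Q) eq with insertRow x r
... | nothing , r' = z≤n , cong suc (suc-injective eq)
... | just y , r' with insertTab y P | insertTab-shape y i P Q (suc-injective eq)
...   | P' , k | (l1 , l2) = s≤s l1 , cong suc l2

rskFrom-glue : ∀ c i ys P1 Q1 P2 Q2 → AllEntries (_≤ c) P1 → Every (c <_) ys → AllEntries (c <_) P2 → length P2 ≡ length Q2 →
  rskFrom i ys (glue P1 P2 , glue Q1 Q2) ≡ (glue P1 (proj₁ (rskFrom i ys (P2 , Q2))) , glue Q1 (proj₂ (rskFrom i ys (P2 , Q2))))
rskFrom-glue c i [] P1 Q1 P2 Q2 a1 ey a2 le = refl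
rskFrom-glue c i (y ∷ ys) P1 Q1 P2 Q2 a1 ey a2 le
  rewrite insertTab-glue c y P1 P2 (ey (here refl)) a1 a2 with insertTab-shape y i P2 Q2 le | insertTab-preserves (c <_) y P2 (ey (here refl)) a2
... | (l1 , l2) | pr with insertTab y P2
...   | P2' , k rewrite addAt-glue i k Q1 Q2 (subst (k ≤_) le l1) = rskFrom-glue c (suc i) ys P1 Q1 P2' (addAt i k Q2) a1 (Every-tail ey) pr l2

row-glue : ∀ k X Y → row k (glue X Y) ≡ row k X ++ row k Y
row-glue k [] Y = refl
row-glue k (x ∷ X) [] = sym (++-identityʳ (row k (x ∷ X)))
row-glue zero (x ∷ X) (y ∷ Y) = refl
row-glue (suc k) (x ∷ X) (y ∷ Y) = row-glue k X Y

row-shift : ∀ k c X → row k (shiftTab c X) ≡ map (_+ c) (row k X)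
row-shift k c [] = refl
row-shift zero c (x ∷ X) = refl
row-shift (suc k) c (x ∷ X) = row-shift k c X

row-Every : ∀ {Pr : ℕ → Set} k X → AllEntries Pr X → Every Pr (row k X)
row-Every k [] a ()
row-Every zero (x ∷ X) a = a (here refl)
row-Every (suc k) (x ∷ X) a = row-Every k X (Every-tail a)

rsk-preservesP : ∀ (Pr : ℕ → Set) i xs P Q → Every Pr xs → AllEntries Pr P → AllEntries Pr (proj₁ (rskFrom i xs (P , Q)))
rsk-preservesP Pr i [] P Q ex ap = ap
rsk-preservesP Pr i (x ∷ xs) P Q ex ap with insertTab x P | insertTab-preserves Pr x P (ex (here refl)) ap
... | P' , k | ap' = rsk-preservesP Pr (suc i) xs P' (addAt i k Q) (Every-tail ex) ap'

rsk-preservesQ : ∀ (Pr : ℕ → Set) i xs P Q → (∀ j → i ≤ j → j < i + length xs → Pr j) → AllEntries Pr Q → AllEntries Pr (proj₂ (rskFrom i xs (P , Q)))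
rsk-preservesQ Pr i [] P Q h aq = aq
rsk-preservesQ Pr i (x ∷ xs) P Q h aq with insertTab x P
... | P' , k = rsk-preservesQ Pr (suc i) xs P' (addAt i k Q)
      (λ j l r → h j (<⇒≤ l) (subst (j <_) (sym (+-suc i (length xs))) r))
      (addAt-preserves Pr i k Q (h i ≤-refl (subst (i <_) (sym (+-suc i (length xs))) (s≤s (m≤m+n i (length xs))))) aq)

rsk-⊕ : ∀ σ₁ σ₂ → Every (_≤ length σ₁) σ₁ → Every (0 <_) σ₂ →
  rsk (σ₁ ⊕ σ₂) ≡ (glue (proj₁ (rsk σ₁)) (shiftTab (length σ₁) (proj₁ (rsk σ₂))) , glue (proj₂ (rsk σ₁)) (shiftTab (length σ₁) (proj₂ (rsk σ₂))))
rsk-⊕ σ₁ σ₂ e1 e2 = begin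
  rskFrom 1 (σ₁ ++ shift n1 σ₂) ([] , [])
    ≡⟨ rskFrom-++ 1 σ₁ (shift n1 σ₂) ([] , []) ⟩
  rskFrom (1 + n1) (shift n1 σ₂) (rsk σ₁)
    ≡⟨ cong₂ (λ x y → rskFrom (1 + n1) (shift n1 σ₂) (x , y)) (sym (glue-[] P1)) (sym (glue-[] Q1)) ⟩
  rskFrom (1 + n1) (shift n1 σ₂) (glue P1 [] , glue Q1 [])
    ≡⟨ rskFrom-glue n1 (1 + n1) (shift n1 σ₂) P1 Q1 [] [] (rsk-preservesP (_≤ n1) 1 σ₁ [] [] e1 (λ ()))
        σ₂-shifted-high (λ ()) refl ⟩
  (glue P1 (proj₁ (rskFrom (1 + n1) (shift n1 σ₂) ([] , []))) , glue Q1 (proj₂ (rskFrom (1 + n1) (shift n1 σ₂) ([] , []))))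
    ≡⟨ cong (λ t → glue P1 (proj₁ t) , glue Q1 (proj₂ t)) (rskFrom-shift 1 n1 σ₂ [] []) ⟩
  (glue P1 (shiftTab n1 (proj₁ (rsk σ₂))) , glue Q1 (shiftTab n1 (proj₂ (rsk σ₂)))) ∎
  where
  open ≡-Reasoning
  n1 = length σ₁
  P1 = proj₁ (rsk σ₁)
  Q1 = proj₂ (rsk σ₁)
  σ₂-shifted-high : ∀ {y} → y ∈ shift n1 σ₂ → n1 < y
  σ₂-shifted-high m with ∈-map⁻ (_+ n1) m
  ... | z , mz , refl = +-monoˡ-≤ n1 (e2 mz)

firstHalf : List ℕ → ℕ → List Step
firstHalf r n = map (λ i → if mem i r then u else d) (range n)

secondHalf : List ℕ → ℕ → List Step
secondHalf r n = map (λ j → if mem j r then u else d) (reverse (range n))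

secondHalf≡reverse : ∀ r n → secondHalf r n ≡ reverse (firstHalf r n)
secondHalf≡reverse r n = reverse-map (λ j → if mem j r then u else d) (range n)

Ψ₁ Ψ₂ : List ℕ → List Step
Ψ₁ σ = firstHalf (row 0 (proj₁ (rsk σ))) (length σ)
Ψ₂ σ = secondHalf (row 1 (proj₂ (rsk σ))) (length σ)

mem-++ : ∀ v xs ys → mem v (xs ++ ys) ≡ mem v xs ∨ mem v ys
mem-++ v [] ys = refl
mem-++ v (x ∷ xs) ys rewrite mem-++ v xs ys = sym (∨-assoc (x ≡ᵇ v) (mem v xs) (mem v ys))

mem-false : ∀ v xs → Every (_≢ v) xs → mem v xs ≡ false
mem-false v [] e = refl
mem-false v (x ∷ xs) e rewrite ≢⇒≡ᵇ-false x v (e (here refl)) = mem-false v xs (Every-tail e)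

≡ᵇ-+ : ∀ x y c → (x + c ≡ᵇ y + c) ≡ (x ≡ᵇ y)
≡ᵇ-+ x y zero rewrite +-identityʳ x | +-identityʳ y = refl
≡ᵇ-+ x y (suc c) rewrite +-suc x c | +-suc y c = ≡ᵇ-+ x y c

mem-shift : ∀ v c xs → mem (v + c) (map (_+ c) xs) ≡ mem v xs
mem-shift v c [] = refl
mem-shift v c (x ∷ xs) rewrite ≡ᵇ-+ x v c | mem-shift v c xs = refl

firstHalf-++ : ∀ r1 r2 n1 n2 → Every (_≤ n1) r1 → Every (0 <_) r2 →
  firstHalf (r1 ++ map (_+ n1) r2) (n1 + n2) ≡ firstHalf r1 n1 ++ firstHalf r2 n2
firstHalf-++ r1 r2 n1 n2 e1 e2 = begin
  firstHalf R (n1 + n2) ≡⟨ map-range F (n1 + n2) ⟩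
  applyUpTo (F ∘ suc) (n1 + n2) ≡⟨ applyUpTo-++ (F ∘ suc) n1 n2 ⟩
  applyUpTo (F ∘ suc) n1 ++ applyUpTo (λ i → F (suc (n1 + i))) n2
    ≡⟨ cong₂ _++_ (applyUpTo-cong _ _ n1 (λ i lt → cong (λ b → if b then u else d) (low i lt)))
                  (applyUpTo-cong _ _ n2 (λ i lt → cong (λ b → if b then u else d) (high i))) ⟩
  applyUpTo (λ i → if mem (suc i) r1 then u else d) n1 ++ applyUpTo (λ i → if mem (suc i) r2 then u else d) n2
    ≡⟨ sym (cong₂ _++_ (map-range _ n1) (map-range _ n2)) ⟩
  firstHalf r1 n1 ++ firstHalf r2 n2 ∎
  where
  open ≡-Reasoning
  R = r1 ++ map (_+ n1) r2
  F : ℕ → Step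
  F i = if mem i R then u else d
  r2-shifted-high : ∀ i → i < n1 → ∀ {y} → y ∈ map (_+ n1) r2 → y ≢ suc i
  r2-shifted-high i lt m e with ∈-map⁻ (_+ n1) m
  ... | z , mz , refl = <-irrefl refl (≤-trans (≤-trans (+-monoˡ-≤ n1 (e2 mz)) (≤-reflexive e)) lt)
  low : ∀ i → i < n1 → mem (suc i) R ≡ mem (suc i) r1
  low i lt rewrite mem-++ (suc i) r1 (map (_+ n1) r2)
    | mem-false (suc i) (map (_+ n1) r2) (r2-shifted-high i lt) = ∨-identityʳ _
  high : ∀ i → mem (suc (n1 + i)) R ≡ mem (suc i) r2
  high i rewrite mem-++ (suc (n1 + i)) r1 (map (_+ n1) r2)
    | mem-false (suc (n1 + i)) r1 (λ m e → <⇒≱ (s≤s (m≤m+n n1 i)) (≤-trans (≤-reflexive (sym e)) (e1 m)))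
    | cong suc (+-comm n1 i) = mem-shift (suc i) n1 r2

secondHalf-++ : ∀ r1 r2 n1 n2 → Every (_≤ n1) r1 → Every (0 <_) r2 →
  secondHalf (r1 ++ map (_+ n1) r2) (n1 + n2) ≡ secondHalf r2 n2 ++ secondHalf r1 n1
secondHalf-++ r1 r2 n1 n2 e1 e2 = begin
  secondHalf (r1 ++ map (_+ n1) r2) (n1 + n2) ≡⟨ secondHalf≡reverse (r1 ++ map (_+ n1) r2) (n1 + n2) ⟩
  reverse (firstHalf (r1 ++ map (_+ n1) r2) (n1 + n2)) ≡⟨ cong reverse (firstHalf-++ r1 r2 n1 n2 e1 e2) ⟩
  reverse (firstHalf r1 n1 ++ firstHalf r2 n2) ≡⟨ reverse-++ (firstHalf r1 n1) (firstHalf r2 n2) ⟩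
  reverse (firstHalf r2 n2) ++ reverse (firstHalf r1 n1) ≡⟨ sym (cong₂ _++_ (secondHalf≡reverse r2 n2) (secondHalf≡reverse r1 n1)) ⟩
  secondHalf r2 n2 ++ secondHalf r1 n1 ∎
  where open ≡-Reasoning

Ψ-⊕ : ∀ σ₁ σ₂ → Every (_≤ length σ₁) σ₁ → Every (0 <_) σ₂ →
  Ψ (σ₁ ⊕ σ₂) ≡ Ψ₁ σ₁ ++ (Ψ₁ σ₂ ++ Ψ₂ σ₂) ++ Ψ₂ σ₁
Ψ-⊕ σ₁ σ₂ e1 e2 = begin
  Ψ₁ (σ₁ ⊕ σ₂) ++ Ψ₂ (σ₁ ⊕ σ₂)
    ≡⟨ cong₂ (λ t n → firstHalf (row 0 (proj₁ t)) n ++ secondHalf (row 1 (proj₂ t)) n) (rsk-⊕ σ₁ σ₂ e1 e2) length-⊕ ⟩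
  firstHalf (row 0 (glue P1 (shiftTab n1 P2))) (n1 + n2) ++ secondHalf (row 1 (glue Q1 (shiftTab n1 Q2))) (n1 + n2)
    ≡⟨ cong₂ (λ x y → firstHalf x (n1 + n2) ++ secondHalf y (n1 + n2)) (glued-row 0 P1 P2) (glued-row 1 Q1 Q2) ⟩
  firstHalf (row 0 P1 ++ map (_+ n1) (row 0 P2)) (n1 + n2) ++ secondHalf (row 1 Q1 ++ map (_+ n1) (row 1 Q2)) (n1 + n2)
    ≡⟨ cong₂ _++_ (firstHalf-++ (row 0 P1) (row 0 P2) n1 n2 (row-Every 0 P1 P1-low) (row-Every 0 P2 P2-pos))
                  (secondHalf-++ (row 1 Q1) (row 1 Q2) n1 n2 (row-Every 1 Q1 Q1-low) (row-Every 1 Q2 Q2-pos)) ⟩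
  (Ψ₁ σ₁ ++ Ψ₁ σ₂) ++ (Ψ₂ σ₂ ++ Ψ₂ σ₁)
    ≡⟨ ++-assoc (Ψ₁ σ₁) (Ψ₁ σ₂) _ ⟩
  Ψ₁ σ₁ ++ Ψ₁ σ₂ ++ Ψ₂ σ₂ ++ Ψ₂ σ₁
    ≡⟨ cong (Ψ₁ σ₁ ++_) (sym (++-assoc (Ψ₁ σ₂) (Ψ₂ σ₂) (Ψ₂ σ₁))) ⟩
  Ψ₁ σ₁ ++ (Ψ₁ σ₂ ++ Ψ₂ σ₂) ++ Ψ₂ σ₁ ∎
  where
  open ≡-Reasoning
  n1 = length σ₁
  n2 = length σ₂
  P1 = proj₁ (rsk σ₁)
  Q1 = proj₂ (rsk σ₁)
  P2 = proj₁ (rsk σ₂)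
  Q2 = proj₂ (rsk σ₂)
  length-⊕ : length (σ₁ ⊕ σ₂) ≡ n1 + n2
  length-⊕ = trans (length-++ σ₁) (cong (n1 +_) (length-map (_+ n1) σ₂))
  glued-row : ∀ k X Y → row k (glue X (shiftTab n1 Y)) ≡ row k X ++ map (_+ n1) (row k Y)
  glued-row k X Y = trans (row-glue k X _) (cong (row k X ++_) (row-shift k n1 Y))
  P1-low : AllEntries (_≤ n1) P1
  P1-low = rsk-preservesP (_≤ n1) 1 σ₁ [] [] e1 (λ ())
  P2-pos : AllEntries (0 <_) P2
  P2-pos = rsk-preservesP (0 <_) 1 σ₂ [] [] e2 (λ ())
  Q1-low : AllEntries (_≤ n1) Q1
  Q1-low = rsk-preservesQ (_≤ n1) 1 σ₁ [] [] (λ j l r → s≤s⁻¹ r) (λ ())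
  Q2-pos : AllEntries (0 <_) Q2
  Q2-pos = rsk-preservesQ (0 <_) 1 σ₂ [] [] (λ j l r → l) (λ ())

Ψ-halves-length : ∀ σ → length (Ψ₁ σ) ≡ length (Ψ₂ σ)
Ψ-halves-length σ = trans (length-map _ (range (length σ)))
  (sym (trans (length-map _ (reverse (range (length σ)))) (length-reverse (range (length σ)))))

-- Part (3): Ψ of a 321-avoiding permutation splits into a climb and a descent.
occ : ℕ → List ℕ → ℕ
occ v [] = 0
occ v (x ∷ xs) = if x ≡ᵇ v then suc (occ v xs) else occ v xs

occ-++ : ∀ v xs ys → occ v (xs ++ ys) ≡ occ v xs + occ v ys
occ-++ v [] ys = refl
occ-++ v (x ∷ xs) ys with x ≡ᵇ v
... | true = cong suc (occ-++ v xs ys)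
... | false = occ-++ v xs ys

occ-↭ : ∀ v {xs ys} → xs ↭ ys → occ v xs ≡ occ v ys
occ-↭ v Perm.refl = refl
occ-↭ v (Perm.prep x p) with x ≡ᵇ v
... | true = cong suc (occ-↭ v p)
... | false = occ-↭ v p
occ-↭ v (Perm.swap x y p) with x ≡ᵇ v | y ≡ᵇ v
... | true | true = cong (suc ∘ suc) (occ-↭ v p)
... | true | false = cong suc (occ-↭ v p)
... | false | true = cong suc (occ-↭ v p)
... | false | false = occ-↭ v p
occ-↭ v (Perm.trans p q) = trans (occ-↭ v p) (occ-↭ v q)

occ⇒∈ : ∀ v xs → 0 < occ v xs → v ∈ xs
occ⇒∈ v (x ∷ xs) pos with x ≡ᵇ v in e
... | true = here (sym (≡ᵇ-true⇒≡ x v e))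
... | false = there (occ⇒∈ v xs pos)

∈⇒occ : ∀ v xs → v ∈ xs → 0 < occ v xs
∈⇒occ v (x ∷ xs) (here refl) rewrite ≡ᵇ-refl v = s≤s z≤n
∈⇒occ v (x ∷ xs) (there m) with x ≡ᵇ v
... | true = s≤s z≤n
... | false = ∈⇒occ v xs m

mem⇒occ : ∀ v xs → (mem v xs ≡ true → 0 < occ v xs) × (mem v xs ≡ false → occ v xs ≡ 0)
mem⇒occ v [] = (λ ()) , (λ _ → refl)
mem⇒occ v (x ∷ xs) with x ≡ᵇ v
... | true = (λ _ → s≤s z≤n) , (λ ())
... | false = mem⇒occ v xs

∉⇒occ≡0 : ∀ v xs → v ∉ xs → occ v xs ≡ 0
∉⇒occ≡0 v [] nm = refl
∉⇒occ≡0 v (x ∷ xs) nm with x ≡ᵇ v in e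
... | true = ⊥-elim (nm (here (sym (≡ᵇ-true⇒≡ x v e))))
... | false = ∉⇒occ≡0 v xs (λ m → nm (there m))

range-snoc : ∀ n → range (suc n) ≡ range n ++ suc n ∷ []
range-snoc n = trans (cong (map suc) (sym (upTo-∷ʳ n))) (map-++ suc (upTo n) (n ∷ []))

∈-range⁻ : ∀ n {v} → v ∈ range n → 1 ≤ v × v ≤ n
∈-range⁻ n m with ∈-applyUpTo⁻ suc n (subst (_ ∈_) (map-applyUpTo id suc n) m)
... | i , lt , refl = s≤s z≤n , lt

occ-singleton-≡ : ∀ v → occ v (v ∷ []) ≡ 1
occ-singleton-≡ v rewrite ≡ᵇ-refl v = refl

occ-singleton-≢ : ∀ v w → w ≢ v → occ v (w ∷ []) ≡ 0
occ-singleton-≢ v w ne rewrite ≢⇒≡ᵇ-false w v ne = refl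

suc∉range : ∀ n → suc n ∉ range n
suc∉range n m = <-irrefl refl (proj₂ (∈-range⁻ n m))

occ-range-≤1 : ∀ v n → occ v (range n) ≤ 1
occ-range-≤1 v zero = z≤n
occ-range-≤1 v (suc n) = subst (λ l → occ v l ≤ 1) (sym (range-snoc n))
  (subst (_≤ 1) (sym (occ-++ v (range n) (suc n ∷ []))) last-value)
  where
  last-value : occ v (range n) + occ v (suc n ∷ []) ≤ 1
  last-value with suc n ≟ v
  ... | yes refl rewrite ∉⇒occ≡0 (suc n) (range n) (suc∉range n) | occ-singleton-≡ (suc n) = ≤-refl
  ... | no ne rewrite occ-singleton-≢ v (suc n) ne | +-identityʳ (occ v (range n)) = occ-range-≤1 v n

occ-range-≡1 : ∀ v n → 1 ≤ v → v ≤ n → occ v (range n) ≡ 1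
occ-range-≡1 (suc v) zero l ()
occ-range-≡1 v (suc n) l r = subst (λ k → occ v k ≡ 1) (sym (range-snoc n))
  (trans (occ-++ v (range n) (suc n ∷ [])) last-value)
  where
  last-value : occ v (range n) + occ v (suc n ∷ []) ≡ 1
  last-value with suc n ≟ v
  ... | yes refl rewrite ∉⇒occ≡0 (suc n) (range n) (suc∉range n) | occ-singleton-≡ (suc n) = refl
  ... | no ne with m≤n⇒m<n∨m≡n r
  ...   | inj₂ e = ⊥-elim (ne (sym e))
  ...   | inj₁ lt rewrite occ-singleton-≢ v (suc n) ne | +-identityʳ (occ v (range n)) = occ-range-≡1 v n l (s≤s⁻¹ lt)

Split321 : List ℕ → Set
Split321 σ = ∀ pre x rest → σ ≡ pre ++ x ∷ rest → ∀ {z x'} → z ∈ pre → x' ∈ rest → ¬ (x < z × x' < x)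

Avoids321-tail : ∀ y σ → Avoids321 (y ∷ σ) → Avoids321 σ
Avoids321-tail y σ av i j k lt1 lt2 = av (Fin.suc i) (Fin.suc j) (Fin.suc k) (s≤s lt1) (s≤s lt2)

positions-around : ∀ (pre : List ℕ) (x : ℕ) (rest : List ℕ) {x' : ℕ} → x' ∈ rest → Σ (Fin (length (pre ++ x ∷ rest))) λ j → Σ (Fin (length (pre ++ x ∷ rest))) λ k →
  j Fin.< k × Data.List.lookup (pre ++ x ∷ rest) j ≡ x × Data.List.lookup (pre ++ x ∷ rest) k ≡ x'
positions-around [] x rest m = Fin.zero , Fin.suc (index m) , s≤s z≤n , refl , sym (lookup-index m)
positions-around (y ∷ pre) x rest m with positions-around pre x rest m
... | j , k , lt , e1 , e2 = Fin.suc j , Fin.suc k , s≤s lt , e1 , e2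

split-avoids : ∀ (pre : List ℕ) (x : ℕ) (rest : List ℕ) → Avoids321 (pre ++ x ∷ rest) → ∀ {z x'} → z ∈ pre → x' ∈ rest → ¬ (x < z × x' < x)
split-avoids (y ∷ pre) x rest av (here refl) x'∈ (x<y , x'<x) with positions-around pre x rest x'∈
... | j , k , j<k , at-j , at-k = av Fin.zero (Fin.suc j) (Fin.suc k) (s≤s z≤n) (s≤s j<k)
      (subst (_< y) (sym at-j) x<y , subst₂ _<_ (sym at-k) (sym at-j) x'<x)
split-avoids (y ∷ pre) x rest av (there mz) mx' = split-avoids pre x rest (Avoids321-tail y _ av) mz mx'

Avoids321⇒Split321 : ∀ σ → Avoids321 σ → Split321 σ
Avoids321⇒Split321 σ av pre x rest refl = split-avoids pre x rest av

cnt : ℕ → List ℕ → ℕ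
cnt v [] = 0
cnt v (x ∷ xs) = if x <ᵇ suc v then suc (cnt v xs) else cnt v xs

cnt-++ : ∀ v xs ys → cnt v (xs ++ ys) ≡ cnt v xs + cnt v ys
cnt-++ v [] ys = refl
cnt-++ v (x ∷ xs) ys with x <ᵇ suc v
... | true = cong suc (cnt-++ v xs ys)
... | false = cnt-++ v xs ys

cnt-len : ∀ v xs → cnt v xs ≤ length xs
cnt-len v [] = z≤n
cnt-len v (x ∷ xs) with x <ᵇ suc v
... | true = s≤s (cnt-len v xs)
... | false = m≤n⇒m≤1+n (cnt-len v xs)

cnt-all : ∀ v xs → Every (_≤ v) xs → cnt v xs ≡ length xs
cnt-all v [] e = refl
cnt-all v (x ∷ xs) e rewrite <⇒<ᵇ-true x (suc v) (s≤s (e (here refl))) = cong suc (cnt-all v xs (Every-tail e))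

cnt-mono : ∀ v w xs → v ≤ w → cnt v xs ≤ cnt w xs
cnt-mono v w [] le = z≤n
cnt-mono v w (x ∷ xs) le with x <ᵇ suc v in e1 | x <ᵇ suc w in e2
... | true | true = s≤s (cnt-mono v w xs le)
... | true | false = ⊥-elim (<⇒≱ (≤-trans (<ᵇ-true⇒< x (suc v) e1) (s≤s le)) (<ᵇ-false⇒≥ x (suc w) e2))
... | false | true = m≤n⇒m≤1+n (cnt-mono v w xs le)
... | false | false = cnt-mono v w xs le

cnt-suc : ∀ w xs → cnt (suc w) xs ≡ cnt w xs + occ (suc w) xs
cnt-suc w [] = refl
cnt-suc w (x ∷ xs) with x ≟ suc w
... | yes refl rewrite <⇒<ᵇ-true (suc w) (suc (suc w)) ≤-refl | ≥⇒<ᵇ-false (suc w) (suc w) ≤-refl | ≡ᵇ-refl w =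
  trans (cong suc (cnt-suc w xs)) (sym (+-suc (cnt w xs) (occ (suc w) xs)))
... | no ne rewrite ≢⇒≡ᵇ-false x (suc w) ne with x <ᵇ suc w in e
...   | true rewrite <⇒<ᵇ-true x (suc (suc w)) (m≤n⇒m≤1+n (<ᵇ-true⇒< x (suc w) e)) = cong suc (cnt-suc w xs)
...   | false rewrite ≥⇒<ᵇ-false x (suc (suc w)) (≤∧≢⇒< (<ᵇ-false⇒≥ x (suc w) e) (λ eq → ne (sym eq))) = cnt-suc w xs

cnt-zero : ∀ xs → cnt 0 xs ≡ occ 0 xs
cnt-zero [] = refl
cnt-zero (zero ∷ xs) = cong suc (cnt-zero xs)
cnt-zero (suc x ∷ xs) = cnt-zero xs

insertRow-nothing : ∀ x r {r'} → insertRow x r ≡ (nothing , r') → r' ≡ r ++ x ∷ [] × Every (_≤ x) r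
insertRow-nothing x [] refl = refl , (λ ())
insertRow-nothing x (y ∷ ys) eq with x <ᵇ y in e
insertRow-nothing x (y ∷ ys) () | true
... | false with insertRow x ys in e2
insertRow-nothing x (y ∷ ys) refl | false | nothing , r2 with insertRow-nothing x ys e2
... | refl , al = refl , Every-∷ (<ᵇ-false⇒≥ x y e) al

insertRow-just : ∀ x r {y r'} → insertRow x r ≡ (just y , r') →
  Σ (List ℕ) λ pa → Σ (List ℕ) λ pb → r ≡ pa ++ y ∷ pb × r' ≡ pa ++ x ∷ pb × Every (_≤ x) pa × x < y
insertRow-just x [] ()
insertRow-just x (z ∷ zs) eq with x <ᵇ z in e
insertRow-just x (z ∷ zs) refl | true = [] , zs , refl , refl , (λ ()) , <ᵇ-true⇒< x z e
... | false with insertRow x zs in e2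
insertRow-just x (z ∷ zs) refl | false | just y , r2 with insertRow-just x zs e2
... | pa , pb , refl , refl , al , lt = z ∷ pa , pb , refl , refl ,
      Every-∷ (<ᵇ-false⇒≥ x z e) al , lt

data TwoRow : Tableau → Tableau → List ℕ → List ℕ → List ℕ → Set where
  sh0 : TwoRow [] [] [] [] []
  sh1 : ∀ r0 q0 → TwoRow (r0 ∷ []) (q0 ∷ []) r0 [] []
  sh2 : ∀ r0 r1 q0 q1 → TwoRow (r0 ∷ r1 ∷ []) (q0 ∷ q1 ∷ []) r0 r1 q1

TwoRow-row0 : ∀ {P Q r0 r1 q1} → TwoRow P Q r0 r1 q1 → row 0 P ≡ r0
TwoRow-row0 sh0 = refl
TwoRow-row0 (sh1 _ _) = refl
TwoRow-row0 (sh2 _ _ _ _) = refl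

TwoRow-row1 : ∀ {P Q r0 r1 q1} → TwoRow P Q r0 r1 q1 → row 1 Q ≡ q1
TwoRow-row1 sh0 = refl
TwoRow-row1 (sh1 _ _) = refl
TwoRow-row1 (sh2 _ _ _ _) = refl

TwoRow-append : ∀ {x i P Q r0 r1 q1 r0'} → TwoRow P Q r0 r1 q1 → insertRow x r0 ≡ (nothing , r0') →
  TwoRow (proj₁ (insertTab x P)) (addAt i (proj₂ (insertTab x P)) Q) r0' r1 q1
TwoRow-append sh0 refl = sh1 _ _
TwoRow-append {x} (sh1 r0 q0) eR with insertRow x r0 | eR
... | .(nothing , _) | refl = sh1 _ _
TwoRow-append {x} (sh2 r0 r1 q0 q1) eR with insertRow x r0 | eR
... | .(nothing , _) | refl = sh2 _ _ _ _

TwoRow-bump : ∀ {x i P Q r0 r1 q1 y0 r0'} → TwoRow P Q r0 r1 q1 → insertRow x r0 ≡ (just y0 , r0') →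
  insertRow y0 r1 ≡ (nothing , r1 ++ y0 ∷ []) →
  TwoRow (proj₁ (insertTab x P)) (addAt i (proj₂ (insertTab x P)) Q) r0' (r1 ++ y0 ∷ []) (q1 ++ i ∷ [])
TwoRow-bump sh0 () e1
TwoRow-bump {x} (sh1 r0 q0) eR e1 with insertRow x r0 | eR
... | .(just _ , _) | refl = sh2 _ _ _ _
TwoRow-bump {x} {y0 = y0} (sh2 r0 r1 q0 q1) eR e1 with insertRow x r0 | eR
... | .(just _ , _) | refl with insertRow y0 r1 | e1
...   | .(nothing , _) | refl = sh2 _ _ _ _

sorted-snoc : ∀ xs {x} → AllPairs _≤_ xs → Every (_≤ x) xs → AllPairs _≤_ (xs ++ x ∷ [])
sorted-snoc [] ap e = [] ∷ []
sorted-snoc (y ∷ xs) (h ∷ ap) e = All.tabulate (Every-++ xs (All.lookup h) (Every-∷ (e (here refl)) (λ ()))) ∷ sorted-snoc xs ap (Every-tail e)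

sorted-after : ∀ pa {y} pb → AllPairs _≤_ (pa ++ y ∷ pb) → Every (y ≤_) pb
sorted-after [] pb (h ∷ _) = All.lookup h
sorted-after (a ∷ pa) pb (_ ∷ ap) = sorted-after pa pb ap

sorted-replace : ∀ pa {y x} pb → AllPairs _≤_ (pa ++ y ∷ pb) → Every (_≤ x) pa → x ≤ y → AllPairs _≤_ (pa ++ x ∷ pb)
sorted-replace [] pb (h ∷ ap) e le = All.tabulate (λ m → ≤-trans le (All.lookup h m)) ∷ ap
sorted-replace (a ∷ pa) {y} {x} pb (h ∷ ap) e le =
  All.tabulate new ∷ sorted-replace pa pb ap (Every-tail e) le
  where
  new : Every (a ≤_) (pa ++ x ∷ pb)
  new m with ∈-++⁻ pa m
  ... | inj₁ m1 = All.lookup h (∈-++⁺ˡ m1)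
  ... | inj₂ (here refl) = e (here refl)
  ... | inj₂ (there m2) = All.lookup h (∈-++⁺ʳ pa (there m2))

-- The recording word after t steps: d at the times recorded in row 1 of Q,
-- u otherwise.  Reversed and flipped, it is the second half of Ψ.
recWord : List ℕ → ℕ → List Step
recWord q t = map (λ j → if mem j q then d else u) (range t)

recWord-snoc : ∀ q t → recWord q (suc t) ≡ recWord q t ++ (if mem (suc t) q then d else u) ∷ []
recWord-snoc q t = trans (cong (map _) (range-snoc t)) (map-++ _ (range t) (suc t ∷ []))

recWord-cong : ∀ q q' t → (∀ j → 1 ≤ j → j ≤ t → mem j q ≡ mem j q') → recWord q t ≡ recWord q' t
recWord-cong q q' t h = map-cong-Every (range t) (λ {j} m → cong (λ b → if b then d else u) (h j (proj₁ (∈-range⁻ t m)) (proj₂ (∈-range⁻ t m))))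

cnt-singleton-≤ : ∀ v a → a ≤ v → cnt v (a ∷ []) ≡ 1
cnt-singleton-≤ v a le rewrite <⇒<ᵇ-true a (suc v) (s≤s le) = refl

cnt-singleton-> : ∀ v a → v < a → cnt v (a ∷ []) ≡ 0
cnt-singleton-> v a lt rewrite ≥⇒<ᵇ-false a (suc v) lt = refl

cnt-replace-smaller : ∀ v pa pb {x y} → x ≤ y → cnt v (pa ++ y ∷ pb) ≤ cnt v (pa ++ x ∷ pb)
cnt-replace-smaller v pa pb {x} {y} x≤y rewrite cnt-++ v pa (y ∷ pb) | cnt-++ v pa (x ∷ pb) =
  +-monoʳ-≤ (cnt v pa) head-smaller
  where
  head-smaller : cnt v (y ∷ pb) ≤ cnt v (x ∷ pb)
  head-smaller with y ≤? v
  ... | yes le rewrite <⇒<ᵇ-true y (suc v) (s≤s le) | <⇒<ᵇ-true x (suc v) (s≤s (≤-trans x≤y le)) = ≤-refl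
  ... | no nle rewrite ≥⇒<ᵇ-false y (suc v) (≰⇒> nle) with x <ᵇ suc v
  ...   | true = n≤1+n _
  ...   | false = ≤-refl

-- Bookkeeping identity for the content invariant in the bumping step.
content-arith : ∀ a xx b r yy p → a + (yy + b) + r ≡ p → a + (xx + b) + (r + yy) ≡ p + xx
content-arith a xx b r yy p e = trans (lemma a xx b r yy) (cong (_+ xx) e)
  where
  lemma : ∀ a xx b r yy → a + (xx + b) + (r + yy) ≡ a + (yy + b) + r + xx
  lemma = solve-∀

module RSK321 (σ : List ℕ) (σ-distinct : ∀ v → occ v σ ≤ 1) (σ-split321 : Split321 σ) where

  -- The invariant after inserting the prefix pre (t letters) of σ = pre · suf:
  --  * P has at most two rows r0, r1 with contents pre, r0 weakly increasing;
  --  * below-rest: an entry of r0 smaller than some entry of r1 is smaller than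
  --    every letter still to come (this is where 321-avoidance enters);
  --  * dominance: for every v, r1 has at most as many entries ≤ v as r0;
  --  * the recording word is a path from 0 to |r0| - |r1|.
  record Invariant (t : ℕ) (pre suf : List ℕ) (P Q : Tableau) : Set where
    field
      r0 r1 q1 : List ℕ
      split : σ ≡ pre ++ suf
      time : length pre ≡ t
      shape : TwoRow P Q r0 r1 q1
      sorted : AllPairs _≤_ r0
      content : ∀ v → occ v (r0 ++ r1) ≡ occ v pre
      below-rest : ∀ {y z} → y ∈ r0 → z ∈ r1 → y < z → ∀ {x'} → x' ∈ suf → y < x'
      dominance : ∀ v → cnt v r1 ≤ cnt v r0
      row1≤row0 : length r1 ≤ length r0
      recPath : Path 0 (recWord q1 t) (length r0 ∸ length r1)
      rec-bounded : Every (_≤ t) q1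

  module InsertStep {t pre x suf P Q} (I : Invariant t pre (x ∷ suf) P Q) where
    open Invariant I

    split' : σ ≡ (pre ++ x ∷ []) ++ suf
    split' = trans split (sym (++-assoc pre (x ∷ []) suf))

    time' : length (pre ++ x ∷ []) ≡ suc t
    time' = trans (length-++ pre) (trans (+-comm (length pre) 1) (cong suc time))

    occ-σ : ∀ v → occ v σ ≡ occ v pre + occ v (x ∷ suf)
    occ-σ v = trans (cong (occ v) split) (occ-++ v pre (x ∷ suf))

    occ-x : occ x pre + suc (occ x suf) ≤ 1
    occ-x = subst (_≤ 1) (trans (occ-σ x) (cong (occ x pre +_) (occ-head))) (σ-distinct x)
      where
      occ-head : occ x (x ∷ suf) ≡ suc (occ x suf)
      occ-head rewrite ≡ᵇ-refl x = refl

    x∉suf : x ∉ suf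
    x∉suf m = no21 (≤-trans (≤-trans (s≤s (∈⇒occ x suf m)) (m≤n+m _ (occ x pre))) occ-x)
      where
      no21 : ¬ (2 ≤ 1)
      no21 (s≤s ())

    inserted : ∀ {z} → z ∈ r0 ++ r1 → z ∈ pre
    inserted {z} m = occ⇒∈ z pre (subst (0 <_) (content z) (∈⇒occ z (r0 ++ r1) m))

    occ-pre≤1 : ∀ v → occ v pre ≤ 1
    occ-pre≤1 v = ≤-trans (m≤m+n (occ v pre) _) (≤-trans (≤-reflexive (sym (occ-σ v))) (σ-distinct v))

    rows-disjoint : ∀ {y z} → y ∈ r0 → z ∈ r1 → y ≢ z
    rows-disjoint {y} my mz refl = <-irrefl refl (≤-trans (s≤s (+-mono-≤ (∈⇒occ y r0 my) (∈⇒occ y r1 mz)))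
      (s≤s (≤-trans (≤-reflexive (sym (occ-++ y r0 r1))) (≤-trans (≤-reflexive (content y)) (occ-pre≤1 y)))))

    -- If x is smaller than an earlier letter, it is smaller than all later ones
    -- (otherwise the three letters form a 321).
    x-below-rest : ∀ {z'} → z' ∈ pre → x < z' → ∀ {x'} → x' ∈ suf → x < x'
    x-below-rest {z'} mz lt {x'} mx' with <-cmp x x'
    ... | tri< a _ _ = a
    ... | tri≈ _ refl _ = ⊥-elim (x∉suf mx')
    ... | tri> _ _ c = ⊥-elim (σ-split321 pre x suf split mz mx' (lt , c))

    +-swap-last : ∀ a b c → a + b + c ≡ a + c + b
    +-swap-last a b c = trans (+-assoc a b c) (trans (cong (a +_) (+-comm b c)) (sym (+-assoc a c b)))

    Invariant' = Invariant (suc t) (pre ++ x ∷ []) suf (proj₁ (insertTab x P)) (addAt (suc t) (proj₂ (insertTab x P)) Q)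

    -- Case 1: x is appended to row 0; the recording word gets an up-step.
    module NoBump (eR : insertRow x r0 ≡ (nothing , r0 ++ x ∷ [])) (al : Every (_≤ x) r0) where
      open ≡-Reasoning

      shape' = TwoRow-append {i = suc t} shape eR

      content′ : ∀ v → occ v ((r0 ++ x ∷ []) ++ r1) ≡ occ v (pre ++ x ∷ [])
      content′ v = begin
        occ v ((r0 ++ x ∷ []) ++ r1) ≡⟨ occ-++ v (r0 ++ x ∷ []) r1 ⟩
        occ v (r0 ++ x ∷ []) + occ v r1 ≡⟨ cong (_+ occ v r1) (occ-++ v r0 (x ∷ [])) ⟩
        occ v r0 + occ v (x ∷ []) + occ v r1 ≡⟨ +-swap-last (occ v r0) (occ v (x ∷ [])) (occ v r1) ⟩
        occ v r0 + occ v r1 + occ v (x ∷ []) ≡⟨ cong (_+ occ v (x ∷ [])) (sym (occ-++ v r0 r1)) ⟩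
        occ v (r0 ++ r1) + occ v (x ∷ []) ≡⟨ cong (_+ occ v (x ∷ [])) (content v) ⟩
        occ v pre + occ v (x ∷ []) ≡⟨ sym (occ-++ v pre (x ∷ [])) ⟩
        occ v (pre ++ x ∷ []) ∎

      below-rest' : ∀ {y z} → y ∈ r0 ++ x ∷ [] → z ∈ r1 → y < z → ∀ {x'} → x' ∈ suf → y < x'
      below-rest' my mz lt mx' with ∈-++⁻ r0 my
      ... | inj₁ m = below-rest m mz lt (there mx')
      ... | inj₂ (here refl) = x-below-rest (inserted (∈-++⁺ʳ r0 mz)) lt mx'

      t+1∉rec : mem (suc t) q1 ≡ false
      t+1∉rec = mem-false (suc t) q1 (λ m e → ≤⇒≯ (rec-bounded m) (subst (t <_) (sym e) ≤-refl))

      height' : suc (length r0 ∸ length r1) ≡ length (r0 ++ x ∷ []) ∸ length r1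
      height' = sym (begin
        length (r0 ++ x ∷ []) ∸ length r1 ≡⟨ cong (_∸ length r1) (length-++ r0) ⟩
        (length r0 + 1) ∸ length r1 ≡⟨ +-∸-comm 1 row1≤row0 ⟩
        (length r0 ∸ length r1) + 1 ≡⟨ +-comm _ 1 ⟩
        suc (length r0 ∸ length r1) ∎)

      recPath' : Path 0 (recWord q1 (suc t)) (length (r0 ++ x ∷ []) ∸ length r1)
      recPath' = subst₂ (Path 0) (sym (trans (recWord-snoc q1 t) (cong (λ b → recWord q1 t ++ (if b then d else u) ∷ []) t+1∉rec))) height'
                 (path-++ recPath (pup pnil))

      invariant' : Invariant'
      invariant' = record
        { r0 = r0 ++ x ∷ [] ; r1 = r1 ; q1 = q1 ; split = split' ; time = time'
        ; shape = shape'
        ; sorted = sorted-snoc r0 sorted al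
        ; content = content′
        ; below-rest = below-rest'
        ; dominance = λ v → ≤-trans (dominance v) (subst (cnt v r0 ≤_) (sym (cnt-++ v r0 (x ∷ []))) (m≤m+n _ _))
        ; row1≤row0 = ≤-trans row1≤row0 (subst (length r0 ≤_) (sym (length-++ r0)) (m≤m+n _ _))
        ; recPath = recPath'
        ; rec-bounded = λ m → m≤n⇒m≤1+n (rec-bounded m)
        }

    sucpred : ∀ {a b} → a < b → suc (pred b) ≡ b
    sucpred {b = suc b} _ = refl

    -- Case 2: x bumps y0 = r0[i] from row 0.  Every entry of row 1 is < y0 (by
    -- below-rest applied to x), so y0 is appended to row 1 and the recording word
    -- gets a down-step; dominance gives |r1| < |r0| beforehand, so the path stays
    -- above 0.
    module Bump (pa pb : List ℕ) (y0 : ℕ) (r0eq : r0 ≡ pa ++ y0 ∷ pb) (eR : insertRow x r0 ≡ (just y0 , pa ++ x ∷ pb))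
              (pale : Every (_≤ x) pa) (xlt : x < y0) where

      y0∈row0 : y0 ∈ r0
      y0∈row0 = subst (y0 ∈_) (sym r0eq) (∈-++⁺ʳ pa (here refl))

      y0-inserted : y0 ∈ pre
      y0-inserted = inserted (∈-++⁺ˡ y0∈row0)

      -- Row 1 lies below y0: an entry z > y0 of row 1 would force y0 < x by below-rest.
      row1≤y0 : Every (_≤ y0) r1
      row1≤y0 mz = ≮⇒≥ (λ lt → <-asym xlt (below-rest y0∈row0 mz lt (here refl)))

      w = pred y0
      suc-w≡y0 : suc w ≡ y0
      suc-w≡y0 = sucpred xlt

      row1<y0 : Every (_≤ w) r1
      row1<y0 {z} mz = s≤s⁻¹ (subst (z <_) (sym suc-w≡y0) (≤∧≢⇒< (row1≤y0 mz) (λ e → rows-disjoint y0∈row0 mz (sym e))))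

      y0-appended : insertRow y0 r1 ≡ (nothing , r1 ++ y0 ∷ [])
      y0-appended = insertRow-append y0 r1 row1≤y0

      shape' = TwoRow-bump {i = suc t} shape eR y0-appended

      rest-above-x : ∀ {x'} → x' ∈ suf → x < x'
      rest-above-x = x-below-rest y0-inserted xlt

      row0-sorted : AllPairs _≤_ (pa ++ y0 ∷ pb)
      row0-sorted = subst (AllPairs _≤_) r0eq sorted

      row0-length : length r0 ≡ length (pa ++ x ∷ pb)
      row0-length = trans (cong length r0eq) (trans (length-++ pa) (sym (length-++ pa)))

      y0∈row0-count : 0 < occ (suc w) r0
      y0∈row0-count = subst (λ z → 0 < occ z r0) (sym suc-w≡y0) (∈⇒occ y0 r0 y0∈row0)

      count-jumps-at-y0 : cnt w r0 < cnt (suc w) r0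
      count-jumps-at-y0 = subst (cnt w r0 <_) (sym (cnt-suc w r0)) (subst (_≤ cnt w r0 + occ (suc w) r0) (+-comm (cnt w r0) 1) (+-monoʳ-≤ (cnt w r0) y0∈row0-count))

      -- Since y0 = w+1 sits in row 0 and row 1 lies below it, dominance is strict
      -- from y0 on; in particular row 1 is strictly shorter than row 0.
      row1<row0 : length r1 < length r0
      row1<row0 = ≤-trans (s≤s (≤-trans (≤-reflexive (sym (cnt-all w r1 row1<y0))) (dominance w))) (≤-trans count-jumps-at-y0 (cnt-len (suc w) r0))

      dominance-strict : ∀ v → y0 ≤ v → cnt v r1 < cnt v r0
      dominance-strict v le = ≤-trans (s≤s (≤-trans (cnt-len v r1) (≤-trans (≤-reflexive (sym (cnt-all w r1 row1<y0))) (dominance w))))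
                         (≤-trans count-jumps-at-y0 (cnt-mono (suc w) v r0 (subst (_≤ v) (sym suc-w≡y0) le)))

      -- Dominance survives: appending y0 to row 1 is paid for by the strict
      -- dominance from y0 on, and replacing y0 by x < y0 in row 0 only helps.
      dominance' : ∀ v → cnt v (r1 ++ y0 ∷ []) ≤ cnt v (pa ++ x ∷ pb)
      dominance' v = ≤-trans row1'≤row0 (subst (λ r → cnt v r ≤ cnt v (pa ++ x ∷ pb)) (sym r0eq) (cnt-replace-smaller v pa pb (<⇒≤ xlt)))
        where
        row1'≤row0 : cnt v (r1 ++ y0 ∷ []) ≤ cnt v r0
        row1'≤row0 rewrite cnt-++ v r1 (y0 ∷ []) with y0 ≤? v
        ... | yes le rewrite cnt-singleton-≤ v y0 le | +-comm (cnt v r1) 1 = dominance-strict v le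
        ... | no nle rewrite cnt-singleton-> v y0 (≰⇒> nle) | +-identityʳ (cnt v r1) = dominance v

      content′ : ∀ v → occ v ((pa ++ x ∷ pb) ++ r1 ++ y0 ∷ []) ≡ occ v (pre ++ x ∷ [])
      content′ v = begin
        occ v ((pa ++ x ∷ pb) ++ r1 ++ y0 ∷ []) ≡⟨ occ-++ v (pa ++ x ∷ pb) (r1 ++ y0 ∷ []) ⟩
        occ v (pa ++ x ∷ pb) + occ v (r1 ++ y0 ∷ [])
          ≡⟨ cong₂ _+_ (trans (occ-++ v pa (x ∷ pb)) (cong (occ v pa +_) (occ-++ v (x ∷ []) pb))) (occ-++ v r1 (y0 ∷ [])) ⟩
        occ v pa + (occ v (x ∷ []) + occ v pb) + (occ v r1 + occ v (y0 ∷ []))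
          ≡⟨ content-arith (occ v pa) (occ v (x ∷ [])) (occ v pb) (occ v r1) (occ v (y0 ∷ [])) (occ v pre) e ⟩
        occ v pre + occ v (x ∷ []) ≡⟨ sym (occ-++ v pre (x ∷ [])) ⟩
        occ v (pre ++ x ∷ []) ∎
        where
        open ≡-Reasoning
        e : occ v pa + (occ v (y0 ∷ []) + occ v pb) + occ v r1 ≡ occ v pre
        e = begin
          occ v pa + (occ v (y0 ∷ []) + occ v pb) + occ v r1
            ≡⟨ cong (_+ occ v r1) (sym (trans (occ-++ v pa (y0 ∷ pb)) (cong (occ v pa +_) (occ-++ v (y0 ∷ []) pb)))) ⟩
          occ v (pa ++ y0 ∷ pb) + occ v r1 ≡⟨ cong (λ z → occ v z + occ v r1) (sym r0eq) ⟩
          occ v r0 + occ v r1 ≡⟨ sym (occ-++ v r0 r1) ⟩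
          occ v (r0 ++ r1) ≡⟨ content v ⟩
          occ v pre ∎

      below-rest' : ∀ {y z} → y ∈ pa ++ x ∷ pb → z ∈ r1 ++ y0 ∷ [] → y < z → ∀ {x'} → x' ∈ suf → y < x'
      below-rest' my mz lt mx' with ∈-++⁻ pa my
      ... | inj₁ mpa = ≤-<-trans (pale mpa) (rest-above-x mx')
      ... | inj₂ (here refl) = rest-above-x mx'
      ... | inj₂ (there mpb) with ∈-++⁻ r1 mz
      ...   | inj₁ mz1 = below-rest (subst (_ ∈_) (sym r0eq) (∈-++⁺ʳ pa (there mpb))) mz1 lt (there mx')
      ...   | inj₂ (here refl) = ⊥-elim (<⇒≱ lt (sorted-after pa pb row0-sorted mpb))

      rec'-old : ∀ j → 1 ≤ j → j ≤ t → mem j (q1 ++ suc t ∷ []) ≡ mem j q1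
      rec'-old j l r rewrite mem-++ j q1 (suc t ∷ []) | ≢⇒≡ᵇ-false (suc t) j (λ e → <-irrefl (sym e) (s≤s r)) = ∨-identityʳ _

      rec'-new : mem (suc t) (q1 ++ suc t ∷ []) ≡ true
      rec'-new rewrite mem-++ (suc t) q1 (suc t ∷ []) | ≡ᵇ-refl t = ∨-zeroʳ _

      recWord' : recWord (q1 ++ suc t ∷ []) (suc t) ≡ recWord q1 t ++ d ∷ []
      recWord' = begin
        recWord (q1 ++ suc t ∷ []) (suc t) ≡⟨ recWord-snoc (q1 ++ suc t ∷ []) t ⟩
        recWord (q1 ++ suc t ∷ []) t ++ (if mem (suc t) (q1 ++ suc t ∷ []) then d else u) ∷ []
          ≡⟨ cong₂ (λ a b → a ++ (if b then d else u) ∷ []) (recWord-cong (q1 ++ suc t ∷ []) q1 t rec'-old) rec'-new ⟩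
        recWord q1 t ++ d ∷ [] ∎
        where open ≡-Reasoning

      height' : length r0 ∸ suc (length r1) ≡ length (pa ++ x ∷ pb) ∸ length (r1 ++ y0 ∷ [])
      height' = cong₂ _∸_ row0-length (trans (sym (+-comm (length r1) 1)) (sym (length-++ r1)))

      recPath' : Path 0 (recWord (q1 ++ suc t ∷ []) (suc t)) (length (pa ++ x ∷ pb) ∸ length (r1 ++ y0 ∷ []))
      recPath' = subst₂ (Path 0) (sym recWord') height' (path-++ (subst (Path 0 (recWord q1 t)) (+-∸-assoc 1 row1<row0) recPath) (pdn pnil))

      invariant' : Invariant'
      invariant' = record
        { r0 = pa ++ x ∷ pb ; r1 = r1 ++ y0 ∷ [] ; q1 = q1 ++ suc t ∷ [] ; split = split' ; time = time'
        ; shape = shape'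
        ; sorted = sorted-replace pa pb row0-sorted pale (<⇒≤ xlt)
        ; content = content′
        ; below-rest = below-rest'
        ; dominance = dominance'
        ; row1≤row0 = subst₂ _≤_ (trans (+-comm 1 (length r1)) (sym (length-++ r1))) row0-length row1<row0
        ; recPath = recPath'
        ; rec-bounded = Every-++ q1 (λ m → m≤n⇒m≤1+n (rec-bounded m)) (Every-∷ {Q = _≤ suc t} ≤-refl (λ ()))
        }

  step : ∀ {t pre x suf P Q} → Invariant t pre (x ∷ suf) P Q →
    Invariant (suc t) (pre ++ x ∷ []) suf (proj₁ (insertTab x P)) (addAt (suc t) (proj₂ (insertTab x P)) Q)
  step {x = x} I with insertRow x (Invariant.r0 I) in eR
  ... | nothing , r0' with insertRow-nothing x (Invariant.r0 I) eR
  ...   | refl , al = InsertStep.NoBump.invariant' I eR al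
  step {x = x} I | just y0 , r0' with insertRow-just x (Invariant.r0 I) eR
  ...   | pa , pb , r0eq , refl , pale , xlt = InsertStep.Bump.invariant' I pa pb y0 r0eq eR pale xlt

secondHalf-recWord : ∀ q n → secondHalf q n ≡ reverse (map flipStep (recWord q n))
secondHalf-recWord q n = trans (reverse-map _ (range n))
  (cong reverse (trans (map-cong (λ j → fl (mem j q)) (range n)) (map-∘ (range n))))
  where
  fl : ∀ b → (if b then u else d) ≡ flipStep (if b then d else u)
  fl true = refl
  fl false = refl

sum≡1-split : ∀ a b → a + b ≡ 1 → 0 < a → a ≡ 1 × b ≡ 0
sum≡1-split (suc zero) zero e _ = refl , refl
sum≡1-split (suc zero) (suc b) ()
sum≡1-split (suc (suc a)) b ()

firstHalf-snoc : ∀ r k → firstHalf r (suc k) ≡ firstHalf r k ++ (if mem (suc k) r then u else d) ∷ []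
firstHalf-snoc r k = trans (cong (map _) (range-snoc k)) (map-++ _ (range k) (suc k ∷ []))

-- For the final rows r0, r1 of a permutation of 1…n, the first half of Ψ is
-- a path from 0 to |r0| - |r1|: among the first k steps there are
-- cnt k r0 up-steps and cnt k r1 down-steps, and dominance keeps the
-- prefixes nonnegative.
module FirstHalfPath (σ : List ℕ) (σ-full : ∀ v → 1 ≤ v → v ≤ length σ → occ v σ ≡ 1)
             (σ-bounded : ∀ v → 0 < occ v σ → 1 ≤ v × v ≤ length σ)
             (r0 r1 : List ℕ) (content : ∀ v → occ v (r0 ++ r1) ≡ occ v σ)
             (dominance : ∀ v → cnt v r1 ≤ cnt v r0) where

  n = length σ

  occ-rows : ∀ v → occ v r0 + occ v r1 ≡ occ v σ
  occ-rows v = trans (sym (occ-++ v r0 r1)) (content v)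

  cnt0-rows : ∀ xs → occ 0 xs ≡ 0 → cnt 0 xs ≡ 0
  cnt0-rows xs e = trans (cnt-zero xs) e

  σ-positive : occ 0 σ ≡ 0
  σ-positive with occ 0 σ in e
  ... | zero = refl
  ... | suc _ with σ-bounded 0 (subst (0 <_) (sym e) (s≤s z≤n))
  ...   | () , _

  in-row1 : ∀ v → 1 ≤ v → v ≤ n → occ v r0 ≡ 0 → occ v r1 ≡ 1
  in-row1 v l r e0 = trans (sym (cong (_+ occ v r1) e0)) (trans (occ-rows v) (σ-full v l r))

  prefix-counts : ∀ k → k ≤ n → nu (firstHalf r0 k) ≡ cnt k r0 × nd (firstHalf r0 k) ≡ cnt k r1
  prefix-counts zero _ = sym (cnt0-rows r0 (m+n≡0⇒m≡0 _ (trans (occ-rows 0) σ-positive))) ,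
                  sym (cnt0-rows r1 (m+n≡0⇒n≡0 (occ 0 r0) (trans (occ-rows 0) σ-positive)))
  prefix-counts (suc k) le with prefix-counts k (≤-trans (n≤1+n k) le)
  ... | (ih1 , ih2) rewrite firstHalf-snoc r0 k | nu-++ (firstHalf r0 k) ((if mem (suc k) r0 then u else d) ∷ []) | nd-++ (firstHalf r0 k) ((if mem (suc k) r0 then u else d) ∷ [])
                          | cnt-suc k r0 | cnt-suc k r1 | ih1 | ih2 with mem (suc k) r0 in em
  ...   | true with sum≡1-split (occ (suc k) r0) (occ (suc k) r1) (trans (occ-rows (suc k)) (σ-full (suc k) (s≤s z≤n) le)) (proj₁ (mem⇒occ (suc k) r0) em)
  ...     | (e0 , e1) rewrite e0 | e1 = refl , refl
  prefix-counts (suc k) le | (ih1 , ih2) | false with proj₂ (mem⇒occ (suc k) r0) em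
  ...     | e0 rewrite e0 | in-row1 (suc k) (s≤s z≤n) le e0 = refl , refl

  entries-bounded : ∀ {z} → z ∈ r0 ++ r1 → z ≤ n
  entries-bounded {z} m = proj₂ (σ-bounded z (subst (0 <_) (content z) (∈⇒occ z (r0 ++ r1) m)))

  firstHalf-path : Path 0 (firstHalf r0 n) (length r0 ∸ length r1)
  firstHalf-path = subst (Path 0 (firstHalf r0 n)) height' (path-from-prefixes 0 (firstHalf r0 n) prefix-condition)
    where
    prefix-dominated : ∀ k → k ≤ n → nd (firstHalf r0 k) ≤ nu (firstHalf r0 k)
    prefix-dominated k le = subst₂ _≤_ (sym (proj₂ (prefix-counts k le))) (sym (proj₁ (prefix-counts k le))) (dominance k)
    take-firstHalf : ∀ k → k ≤ n → take k (firstHalf r0 n) ≡ firstHalf r0 k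
    take-firstHalf k le = trans (take-map k (range n))
      (cong (map _) (trans
         (cong (take k) (trans (map-applyUpTo id suc n) (cong (applyUpTo suc) (sym (m+[n∸m]≡n le)))))
         (trans (take-applyUpTo suc k (n ∸ k)) (sym (map-applyUpTo id suc k)))))
    length-firstHalf : length (firstHalf r0 n) ≡ n
    length-firstHalf = trans (length-map _ (range n)) (trans (length-map suc (upTo n)) (length-upTo n))
    prefix-condition : ∀ k → nd (take k (firstHalf r0 n)) ≤ 0 + nu (take k (firstHalf r0 n))
    prefix-condition k with k ≤? n
    ... | yes le rewrite take-firstHalf k le = prefix-dominated k le
    ... | no nle rewrite take-all k (firstHalf r0 n) (subst (_≤ k) (sym length-firstHalf) (<⇒≤ (≰⇒> nle))) = prefix-dominated n ≤-refl
    height' : 0 + nu (firstHalf r0 n) ∸ nd (firstHalf r0 n) ≡ length r0 ∸ length r1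
    height' = cong₂ _∸_ (trans (proj₁ (prefix-counts n ≤-refl)) (cnt-all n r0 (λ m → entries-bounded (∈-++⁺ˡ m))))
                    (trans (proj₂ (prefix-counts n ≤-refl)) (cnt-all n r1 (λ m → entries-bounded (∈-++⁺ʳ r0 m))))

perm-occ≤1 : ∀ {σ} → IsPerm σ → ∀ v → occ v σ ≤ 1
perm-occ≤1 {σ} p v = subst (_≤ 1) (sym (occ-↭ v p)) (occ-range-≤1 v (length σ))

perm-occ≡1 : ∀ {σ} → IsPerm σ → ∀ v → 1 ≤ v → v ≤ length σ → occ v σ ≡ 1
perm-occ≡1 {σ} p v l r = trans (occ-↭ v p) (occ-range-≡1 v (length σ) l r)

perm-bounded : ∀ {σ} → IsPerm σ → ∀ v → 0 < occ v σ → 1 ≤ v × v ≤ length σ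
perm-bounded {σ} p v pos = ∈-range⁻ (length σ) (occ⇒∈ v (range (length σ)) (subst (0 <_) (occ-↭ v p) pos))

perm-entries : ∀ {σ} → IsPerm σ → Every (λ v → 1 ≤ v × v ≤ length σ) σ
perm-entries {σ} p v∈ = ∈-range⁻ (length σ) (∈-resp-↭ p v∈)

module Ψ321 (σ : List ℕ) (σ∈S321 : InS321 σ) where
  n = length σ

  open RSK321 σ (perm-occ≤1 (proj₁ σ∈S321)) (Avoids321⇒Split321 σ (proj₂ σ∈S321))

  MidSplit : Tableau × Tableau → Set
  MidSplit R = ∃ λ h → Path 0 (firstHalf (row 0 (proj₁ R)) n) h × Path h (secondHalf (row 1 (proj₂ R)) n) 0

  -- At the end, row 0 of P gives the climb (FirstHalfPath) and the recording
  -- path, reversed, gives the descent.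
  finish : ∀ {t pre P Q} → Invariant t pre [] P Q → MidSplit (P , Q)
  finish {t} {pre} {P} {Q} I = (length r0 ∸ length r1) , firstHalf-P , secondHalf-Q
    where
    open Invariant I
    pre≡σ : pre ≡ σ
    pre≡σ = trans (sym (++-identityʳ pre)) (sym split)
    content′ : ∀ v → occ v (r0 ++ r1) ≡ occ v σ
    content′ v = trans (content v) (cong (occ v) pre≡σ)
    t≡n : t ≡ n
    t≡n = trans (sym time) (cong length pre≡σ)
    open FirstHalfPath σ (perm-occ≡1 (proj₁ σ∈S321)) (perm-bounded (proj₁ σ∈S321)) r0 r1 content′ dominance using (firstHalf-path)
    firstHalf-P : Path 0 (firstHalf (row 0 P) n) (length r0 ∸ length r1)
    firstHalf-P = subst (λ r → Path 0 (firstHalf r n) (length r0 ∸ length r1)) (sym (TwoRow-row0 shape)) firstHalf-path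
    secondHalf-Q : Path (length r0 ∸ length r1) (secondHalf (row 1 Q) n) 0
    secondHalf-Q = subst (λ r → Path (length r0 ∸ length r1) (secondHalf r n) 0) (sym (TwoRow-row1 shape))
           (subst (λ z → Path (length r0 ∸ length r1) z 0) (sym (secondHalf-recWord q1 n))
             (path-reverse (subst (λ z → Path 0 (recWord q1 z) (length r0 ∸ length r1)) t≡n recPath)))
  run : ∀ t pre suf P Q → Invariant t pre suf P Q → MidSplit (rskFrom (suc t) suf (P , Q))
  run t pre [] P Q I = finish I
  run t pre (x ∷ suf) P Q I with insertTab x P | step I
  ... | P' , k | I' = run (suc t) (pre ++ x ∷ []) suf P' (addAt (suc t) k Q) I'

  initial : Invariant 0 [] σ [] []
  initial = record
    { r0 = [] ; r1 = [] ; q1 = [] ; split = refl ; time = refl ; shape = sh0 ; sorted = []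
    ; content = λ v → refl ; below-rest = λ () ; dominance = λ v → z≤n ; row1≤row0 = z≤n ; recPath = pnil ; rec-bounded = λ () }

  midsplit : MidSplit (rsk σ)
  midsplit = run 0 [] σ [] [] initial

Ψ-midsplit : ∀ σ → InS321 σ → ∃ λ h → Path 0 (Ψ₁ σ) h × Path h (Ψ₂ σ) 0
Ψ-midsplit σ σ∈S321 = Ψ321.midsplit σ σ∈S321

proposition3p5 : (σ₁ σ₂ : List ℕ) → InS321 σ₁ → InS321 σ₂ →
    Θ (σ₁ ⊕ σ₂) ≡ Θ σ₂ ⊗ Θ σ₁
proposition3p5 σ₁ σ₂ σ₁∈S321 σ₂∈S321
  with Ψ-midsplit σ₁ σ₁∈S321 | Ψ-midsplit σ₂ σ₂∈S321
... | h , climb₁ , descent₁ | _ , climb₂ , descent₂ = begin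
  Φinv (Ψ (σ₁ ⊕ σ₂))
    ≡⟨ cong Φinv (Ψ-⊕ σ₁ σ₂ (proj₂ ∘ perm-entries (proj₁ σ₁∈S321)) (proj₁ ∘ perm-entries (proj₁ σ₂∈S321))) ⟩
  Φinv (Ψ₁ σ₁ ++ Ψ σ₂ ++ Ψ₂ σ₁)
    ≡⟨ Φinv-insert (Ψ₁ σ₁) (Ψ₂ σ₁) (Ψ σ₂) h climb₁ descent₁ (path-++ climb₂ descent₂) (Ψ-halves-length σ₁) ⟩
  Φinv (Ψ σ₂) ⊗ Φinv (Ψ₁ σ₁ ++ Ψ₂ σ₁) ∎
  where open ≡-Reasoning
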